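{- For all $n\ge 3$, the number of permutations $\sigma\in S_n(231)$ with $\mathrm{maxdrop}(\sigma)=2$ and $\mathrm{des}(\sigma)=2$ equals $\binom{n+1}{4}$.
   Context: For a permutation $\sigma=\sigma_1\cdots\sigma_n$ of $[n]$, $\mathrm{des}(\sigma)$ is the number of $i\in[n-1]$ with $\sigma_i>\sigma_{i+1}$, and $\mathrm{maxdrop}(\sigma)=\max\{i-\sigma_i : i\in[n]\}$. $S_n(231)$ is the set of permutations of $[n]$ with no indices $a<b<c$ such that $\sigma_c<\sigma_a<\sigma_b$. -}

module Defs where

open import Data.Nat using (ℕ; zero; suc; _∸_; _⊔_; _<ᵇ_; _≡ᵇ_)
open import Data.Bool using (Bool; true; false; _∧_; _∨_; not)
open import Data.Fin using (Fin; toℕ) renaming (zero to fzero; suc to fsuc)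
open import Data.Vec using (Vec; []; _∷_; lookup)
open import Data.List using (List; []; _∷_; concatMap; map; length; filterᵇ; allFin)

-- A permutation σ of [n] is represented by its one-line notation, a vector
-- w : Vec (Fin n) n with pairwise distinct entries.  Position i : Fin n is the
-- paper's index toℕ i + 1, and value lookup w i is the paper's σ_{i+1} - 1.

allVecs : {A : Set} → List A → (k : ℕ) → List (Vec A k)
allVecs xs zero    = [] ∷ []
allVecs xs (suc k) = concatMap (λ x → map (x ∷_) (allVecs xs k)) xs

allF : (n : ℕ) → (Fin n → Bool) → Bool
allF zero    p = true
allF (suc n) p = p fzero ∧ allF n (λ i → p (fsuc i))

anyF : (n : ℕ) → (Fin n → Bool) → Bool
anyF n p = not (allF n (λ i → not (p i)))

maxF : (n : ℕ) → (Fin n → ℕ) → ℕ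
maxF zero    f = 0
maxF (suc n) f = f fzero ⊔ maxF n (λ i → f (fsuc i))

countF : (n : ℕ) → (Fin n → Bool) → ℕ
countF zero    p = 0
countF (suc n) p = (if p fzero then 1 else 0) Data.Nat.+ countF n (λ i → p (fsuc i))
  where open import Data.Bool using (if_then_else_)

_<F_ : {n : ℕ} → Fin n → Fin n → Bool
i <F j = toℕ i <ᵇ toℕ j

module _ {n : ℕ} (w : Vec (Fin n) n) where
  val : Fin n → ℕ
  val i = toℕ (lookup w i)

  isPerm : Bool
  isPerm = allF n λ i → allF n λ j → not (i <F j) ∨ not (val i ≡ᵇ val j)

  contains231 : Bool
  contains231 = anyF n λ a → anyF n λ b → anyF n λ c →
    (a <F b) ∧ (b <F c) ∧ (val c <ᵇ val a) ∧ (val a <ᵇ val b)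

  des : ℕ
  des = countF n λ i → anyF n λ j → (toℕ j ≡ᵇ suc (toℕ i)) ∧ (val j <ᵇ val i)

  -- maxdrop = max (i - σ_i); truncated subtraction is harmless since the
  -- maximum over a permutation (n ≥ 1) is always ≥ 0.
  maxdrop : ℕ
  maxdrop = maxF n λ i → toℕ i ∸ val i

perms : (n : ℕ) → List (Vec (Fin n) n)
perms n = filterᵇ isPerm (allVecs (allFin n) n)

S231 : (n : ℕ) → List (Vec (Fin n) n)
S231 n = filterᵇ (λ w → not (contains231 w)) (perms n)

countMaxdropDes : (n d k : ℕ) → ℕ
countMaxdropDes n d k = length (filterᵇ (λ w → (maxdrop w ≡ᵇ d) ∧ (des w ≡ᵇ k)) (S231 n))

module Submission where

-- A permutation is handled through its one-line word of naturals (values and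
-- positions counted from 0, which leaves drops unchanged).  We count more
-- generally admissible words: 231-avoiding arrangements v of a window [o, o + m)
-- of consecutive values placed at positions o + s, o + s + 1, … (slack s), all
-- of whose drops (position ∸ letter) are at most B.  If v starts with o + k then
-- 231-avoidance and the pigeonhole principle force v = (o + k) ∷ α ++ β with α
-- a permutation of [o, o + k) and β one of [o + k + 1, o + m); v is admissible
-- iff s ∸ k ≤ B, α is admissible with slack s + 1 and β with slack s, and then
-- des v = [k > 0] + des α + des β.  Summing over the first letter gives a
-- convolution recurrence for the number M of admissible words with given
-- descents.  We solve it according to the room B − s: slack above B admits no
-- word, slack B only the increasing one, room one gives C(m, 2d) words with d
-- descents, and room two gives 1, C(m, 2), C(m + 1, 4) + C(m, 4) words with
-- 0, 1, 2 descents.  Finally the statistics of Defs are those of the one-line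
-- word, and maxdrop = 2 means "all drops ≤ 2, not all drops ≤ 1", so the count
-- is (C(n + 1, 4) + C(n, 4)) − C(n, 4).

open import Defs
open import Data.Nat using (ℕ; zero; suc; _+_; _*_; _∸_; _⊔_; _≤_; _<_; _≤ᵇ_; _<ᵇ_; _≡ᵇ_; z≤n; s≤s; s≤s⁻¹)
open import Data.Nat.Properties
open import Data.Nat.Induction using (<-rec)
open import Data.Nat.Solver using (module +-*-Solver)
open import Data.Nat.Combinatorics using (_C_; nCk+nC[k+1]≡[n+1]C[k+1]; nC1≡n)
open import Data.Bool using (Bool; true; false; _∧_; _∨_; not; if_then_else_)
open import Data.Bool.Properties using (∧-zeroʳ; ∨-identityʳ; ∨-assoc; ∧-assoc; ∧-commutativeMonoid; T-≡)
open import Data.Bool.ListAction using (all; any)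
open import Data.Fin using (Fin; toℕ) renaming (zero to fzero; suc to fsuc)
open import Data.Vec using (Vec; []; _∷_; lookup; toList)
import Data.Vec as Vec
open import Data.List using (List; []; _∷_; _++_; map; concatMap; length; filterᵇ; allFin; upTo; applyUpTo; tabulate)
open import Data.List.Properties using (length-++; map-∘; map-concatMap; concatMap-cong; concatMap-map; map-tabulate)
open import Data.List.Relation.Unary.All using (All; []; _∷_)
import Data.List.Relation.Unary.All as All
open import Data.List.Relation.Unary.All.Properties using (map⁺; concat⁺; applyUpTo⁺₁)
open import Data.Product using (_×_; _,_; proj₁; proj₂)
open import Data.Empty using (⊥; ⊥-elim)
open import Function using (_∘_; id)
open import Function.Bundles using (Equivalence)
open import Algebra.Bundles using (CommutativeMonoid)
open import Algebra.Properties.CommutativeSemigroup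
  (CommutativeMonoid.commutativeSemigroup ∧-commutativeMonoid) using () renaming (interchange to ∧-interchange)
open import Algebra.Properties.CommutativeSemigroup +-commutativeSemigroup
  using () renaming (interchange to +-interchange)
open import Relation.Binary.PropositionalEquality

∧-elimˡ : ∀ {a b} → a ∧ b ≡ true → a ≡ true
∧-elimˡ {true} _ = refl

∧-elimʳ : ∀ {a b} → a ∧ b ≡ true → b ≡ true
∧-elimʳ {true} e = e

∧-intro : ∀ {a b} → a ≡ true → b ≡ true → a ∧ b ≡ true
∧-intro refl refl = refl

∨-introˡ : ∀ {a} b → a ≡ true → a ∨ b ≡ true
∨-introˡ b refl = refl

∨-introʳ : ∀ a {b} → b ≡ true → a ∨ b ≡ true
∨-introʳ true  _ = refl
∨-introʳ false e = e

∨-false-elimˡ : ∀ {a b} → a ∨ b ≡ false → a ≡ false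
∨-false-elimˡ {false} _ = refl

∨-false-elimʳ : ∀ {a b} → a ∨ b ≡ false → b ≡ false
∨-false-elimʳ {false} e = e

not-true : ∀ {a} → not a ≡ true → a ≡ false
not-true {false} _ = refl

not-false : ∀ {a} → a ≡ false → not a ≡ true
not-false refl = refl

true≢false : ∀ {a} → a ≡ true → a ≡ false → ⊥
true≢false refl ()

∧-congʳ-when : ∀ r {X Y} → (r ≡ true → X ≡ Y) → r ∧ X ≡ r ∧ Y
∧-congʳ-when true  f = f refl
∧-congʳ-when false f = refl

bool-ext : ∀ {a b} → (a ≡ true → b ≡ true) → (b ≡ true → a ≡ true) → a ≡ b
bool-ext {true}  {true}  f g = refl
bool-ext {true}  {false} f g = sym (f refl)
bool-ext {false} {true}  f g = g refl
bool-ext {false} {false} f g = refl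

⟦_⟧ : Bool → ℕ
⟦ b ⟧ = if b then 1 else 0

<ᵇ→< : ∀ m n → (m <ᵇ n) ≡ true → m < n
<ᵇ→< m n e = <ᵇ⇒< m n (Equivalence.from T-≡ e)

<→<ᵇ : ∀ {m n} → m < n → (m <ᵇ n) ≡ true
<→<ᵇ p = Equivalence.to T-≡ (<⇒<ᵇ p)

≤ᵇ→≤ : ∀ m n → (m ≤ᵇ n) ≡ true → m ≤ n
≤ᵇ→≤ m n e = ≤ᵇ⇒≤ m n (Equivalence.from T-≡ e)

≤→≤ᵇ : ∀ {m n} → m ≤ n → (m ≤ᵇ n) ≡ true
≤→≤ᵇ p = Equivalence.to T-≡ (≤⇒≤ᵇ p)

≡ᵇ→≡ : ∀ m n → (m ≡ᵇ n) ≡ true → m ≡ n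
≡ᵇ→≡ m n e = ≡ᵇ⇒≡ m n (Equivalence.from T-≡ e)

≡→≡ᵇ : ∀ m {n} → m ≡ n → (m ≡ᵇ n) ≡ true
≡→≡ᵇ m {n} p = Equivalence.to T-≡ (≡⇒≡ᵇ m n p)

<ᵇ-false→≥ : ∀ m n → (m <ᵇ n) ≡ false → n ≤ m
<ᵇ-false→≥ m n e = ≮⇒≥ (λ p → true≢false (<→<ᵇ p) e)

≥→<ᵇ-false : ∀ {m n} → n ≤ m → (m <ᵇ n) ≡ false
≥→<ᵇ-false {m} {n} p with m <ᵇ n in eq
... | true  = ⊥-elim (<⇒≱ (<ᵇ→< m n eq) p)
... | false = refl

>→≤ᵇ-false : ∀ {m n} → n < m → (m ≤ᵇ n) ≡ false
>→≤ᵇ-false {m} {n} p with m ≤ᵇ n in eq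
... | true  = ⊥-elim (<⇒≱ p (≤ᵇ→≤ m n eq))
... | false = refl

≢→≡ᵇ-false : ∀ {m n} → m ≢ n → (m ≡ᵇ n) ≡ false
≢→≡ᵇ-false {m} {n} p with m ≡ᵇ n in eq
... | true  = ⊥-elim (p (≡ᵇ→≡ m n eq))
... | false = refl

_∈ᵇ_ : ℕ → List ℕ → Bool
x ∈ᵇ v = any (x ≡ᵇ_) v

distinct : List ℕ → Bool
distinct []      = true
distinct (x ∷ v) = not (x ∈ᵇ v) ∧ distinct v

inWindow : ℕ → ℕ → List ℕ → Bool
inWindow lo hi = all (λ y → (lo ≤ᵇ y) ∧ (y <ᵇ hi))

-- x is the '2' of a 231 occurrence in x ∷ v: some later y > x is followed by some z < x
leads231 : ℕ → List ℕ → Bool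
leads231 x []      = false
leads231 x (y ∷ v) = ((x <ᵇ y) ∧ any (_<ᵇ x) v) ∨ leads231 x v

has231 : List ℕ → Bool
has231 []      = false
has231 (x ∷ v) = leads231 x v ∨ has231 v

descentsFrom : ℕ → List ℕ → ℕ
descentsFrom x []      = 0
descentsFrom x (y ∷ v) = ⟦ y <ᵇ x ⟧ + descentsFrom y v

descents : List ℕ → ℕ
descents []      = 0
descents (x ∷ v) = descentsFrom x v

dropsAtMost : ℕ → ℕ → List ℕ → Bool
dropsAtMost B c []      = true
dropsAtMost B c (x ∷ v) = ((c ∸ x) ≤ᵇ B) ∧ dropsAtMost B (suc c) v

admissible : ℕ → ℕ → ℕ → List ℕ → Bool
admissible B o c v =
  distinct v ∧ (inWindow o (o + length v) v ∧ (not (has231 v) ∧ dropsAtMost B c v))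

Holds : List ℕ → (ℕ → Bool) → Set
Holds v p = ∀ y → (y ∈ᵇ v) ≡ true → p y ≡ true

all→Holds : ∀ {p} v → all p v ≡ true → Holds v p
all→Holds {p} (x ∷ v) e y m with y ≡ᵇ x in eq
... | true  = subst (λ z → p z ≡ true) (sym (≡ᵇ→≡ y x eq)) (∧-elimˡ e)
... | false = all→Holds v (∧-elimʳ e) y m

∈-head : ∀ x v → (x ∈ᵇ (x ∷ v)) ≡ true
∈-head x v = ∨-introˡ _ (≡→≡ᵇ x refl)

∈-tail : ∀ y x v → (y ∈ᵇ v) ≡ true → (y ∈ᵇ (x ∷ v)) ≡ true
∈-tail y x v m = ∨-introʳ _ m

∈-++ˡ : ∀ y α β → (y ∈ᵇ α) ≡ true → (y ∈ᵇ (α ++ β)) ≡ true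
∈-++ˡ y (x ∷ α) β m with y ≡ᵇ x
... | true  = refl
... | false = ∈-++ˡ y α β m

∈-++ʳ : ∀ y α β → (y ∈ᵇ β) ≡ true → (y ∈ᵇ (α ++ β)) ≡ true
∈-++ʳ y []      β m = m
∈-++ʳ y (x ∷ α) β m = ∈-tail y x (α ++ β) (∈-++ʳ y α β m)

Holds-∷ : ∀ {p} a v → p a ≡ true → Holds v p → Holds (a ∷ v) p
Holds-∷ {p} a v pa h y m with y ≡ᵇ a in eq
... | true  = subst (λ z → p z ≡ true) (sym (≡ᵇ→≡ y a eq)) pa
... | false = h y m

Holds-tail : ∀ {p} x v → Holds (x ∷ v) p → Holds v p
Holds-tail x v h y m = h y (∈-tail y x v m)

∉-Holds : ∀ {p} v a → Holds v p → p a ≡ false → (a ∈ᵇ v) ≡ false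
∉-Holds v a h pa with a ∈ᵇ v in eq
... | true  = ⊥-elim (true≢false (h a eq) pa)
... | false = refl

∉⇒≢ : ∀ x v y → (x ∈ᵇ v) ≡ false → (y ∈ᵇ v) ≡ true → y ≢ x
∉⇒≢ x v y x∉v y∈v refl = true≢false y∈v x∉v

all-++ : ∀ (p : ℕ → Bool) α β → all p (α ++ β) ≡ all p α ∧ all p β
all-++ p []      β = refl
all-++ p (x ∷ α) β = trans (cong (p x ∧_) (all-++ p α β)) (sym (∧-assoc (p x) _ _))

any-++ : ∀ (p : ℕ → Bool) α β → any p (α ++ β) ≡ any p α ∨ any p β
any-++ p []      β = refl
any-++ p (x ∷ α) β = trans (cong (p x ∨_) (any-++ p α β)) (sym (∨-assoc (p x) _ _))

∈-++ : ∀ y α β → y ∈ᵇ (α ++ β) ≡ (y ∈ᵇ α) ∨ (y ∈ᵇ β)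
∈-++ y = any-++ (y ≡ᵇ_)

distinct-++ : ∀ α β → distinct (α ++ β) ≡ true →
  distinct α ≡ true × distinct β ≡ true × (∀ a → (a ∈ᵇ α) ≡ true → (a ∈ᵇ β) ≡ false)
distinct-++ []      β e = refl , e , λ a ()
distinct-++ (x ∷ α) β e with distinct-++ α β (∧-elimʳ e)
... | dα , dβ , disj = ∧-intro (not-false x∉α) dα , dβ , disj′
  where
  x∉αβ : (x ∈ᵇ (α ++ β)) ≡ false
  x∉αβ = not-true (∧-elimˡ e)
  x∉α : (x ∈ᵇ α) ≡ false
  x∉α = ∨-false-elimˡ (trans (sym (∈-++ x α β)) x∉αβ)
  x∉β : (x ∈ᵇ β) ≡ false
  x∉β = ∨-false-elimʳ (trans (sym (∈-++ x α β)) x∉αβ)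
  disj′ : ∀ a → (a ∈ᵇ (x ∷ α)) ≡ true → (a ∈ᵇ β) ≡ false
  disj′ a m with a ≡ᵇ x in eq
  ... | true  = subst (λ z → (z ∈ᵇ β) ≡ false) (sym (≡ᵇ→≡ a x eq)) x∉β
  ... | false = disj a m

-- Pigeonhole: a distinct word with letters in [lo, lo + r) has length ≤ r.
-- Proof by removing the largest letter lo + r - 1.

remove : ℕ → List ℕ → List ℕ
remove t []      = []
remove t (y ∷ v) = if y ≡ᵇ t then remove t v else y ∷ remove t v

remove-⊆ : ∀ t y v → (y ∈ᵇ remove t v) ≡ true → (y ∈ᵇ v) ≡ true
remove-⊆ t y (x ∷ v) m with x ≡ᵇ t
... | true = ∈-tail y x v (remove-⊆ t y v m)
... | false with y ≡ᵇ x
...   | true  = refl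
...   | false = remove-⊆ t y v m

remove-≢ : ∀ t y v → (y ∈ᵇ remove t v) ≡ true → y ≢ t
remove-≢ t y (x ∷ v) m with x ≡ᵇ t in eq
... | true = remove-≢ t y v m
... | false with y ≡ᵇ x in eq′
...   | true  = λ y≡t → true≢false (≡→≡ᵇ x (trans (sym (≡ᵇ→≡ y x eq′)) y≡t)) eq
...   | false = remove-≢ t y v m

remove-distinct : ∀ t v → distinct v ≡ true → distinct (remove t v) ≡ true
remove-distinct t []      e = refl
remove-distinct t (x ∷ v) e with x ≡ᵇ t
... | true  = remove-distinct t v (∧-elimʳ e)
... | false = ∧-intro (not-false x∉) (remove-distinct t v (∧-elimʳ e))
  where
  x∉ : (x ∈ᵇ remove t v) ≡ false
  x∉ with x ∈ᵇ remove t v in eq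
  ... | true  = ⊥-elim (true≢false (remove-⊆ t x v eq) (not-true (∧-elimˡ e)))
  ... | false = refl

remove-∉ : ∀ t v → (t ∈ᵇ v) ≡ false → remove t v ≡ v
remove-∉ t []      e = refl
remove-∉ t (x ∷ v) e with x ≡ᵇ t in eq
... | true  = ⊥-elim (true≢false (∨-introˡ _ (≡→≡ᵇ t (sym (≡ᵇ→≡ x t eq)))) e)
... | false = cong (x ∷_) (remove-∉ t v (∨-false-elimʳ e))

remove-length : ∀ t v → distinct v ≡ true → length v ≤ suc (length (remove t v))
remove-length t []      e = z≤n
remove-length t (x ∷ v) e with x ≡ᵇ t in eq
... | true  = ≤-reflexive (cong (suc ∘ length) (sym (remove-∉ t v t∉v)))
  where
  t∉v : (t ∈ᵇ v) ≡ false
  t∉v = subst (λ z → (z ∈ᵇ v) ≡ false) (≡ᵇ→≡ x t eq) (not-true (∧-elimˡ e))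
... | false = s≤s (remove-length t v (∧-elimʳ e))

pigeonhole : ∀ r lo v → distinct v ≡ true → Holds v (λ y → (lo ≤ᵇ y) ∧ (y <ᵇ lo + r)) →
  length v ≤ r
pigeonhole zero    lo []      d h = z≤n
pigeonhole zero    lo (x ∷ v) d h = ⊥-elim (<⇒≱ x<lo lo≤x)
  where
  hx = h x (∈-head x v)
  lo≤x : lo ≤ x
  lo≤x = ≤ᵇ→≤ lo x (∧-elimˡ hx)
  x<lo : x < lo
  x<lo = subst (x <_) (+-identityʳ lo) (<ᵇ→< x _ (∧-elimʳ hx))
pigeonhole (suc r) lo v d h =
  ≤-trans (remove-length (lo + r) v d)
          (s≤s (pigeonhole r lo (remove (lo + r) v) (remove-distinct _ v d) h′))
  where
  h′ : Holds (remove (lo + r) v) (λ y → (lo ≤ᵇ y) ∧ (y <ᵇ lo + r))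
  h′ y m = ∧-intro (∧-elimˡ hy) (<→<ᵇ (≤∧≢⇒< y≤lo+r (remove-≢ _ y v m)))
    where
    hy = h y (remove-⊆ _ y v m)
    y≤lo+r : y ≤ lo + r
    y≤lo+r = s≤s⁻¹ (subst (suc y ≤_) (+-suc lo r) (<ᵇ→< y _ (∧-elimʳ hy)))

all-cong : ∀ {p q : ℕ → Bool} v → (∀ y → (y ∈ᵇ v) ≡ true → p y ≡ q y) → all p v ≡ all q v
all-cong []      h = refl
all-cong (x ∷ v) h = cong₂ _∧_ (h x (∈-head x v)) (all-cong v (λ y m → h y (∈-tail y x v m)))

any-none : ∀ (p : ℕ → Bool) v → (∀ y → (y ∈ᵇ v) ≡ true → p y ≡ false) → any p v ≡ false
any-none p []      h = refl
any-none p (x ∷ v) h rewrite h x (∈-head x v) = any-none p v (λ y m → h y (∈-tail y x v m))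

not-∨ : ∀ a b → not (a ∨ b) ≡ not a ∧ not b
not-∨ true  b = refl
not-∨ false b = refl

distinct-++-disjoint : ∀ α β → Holds α (λ a → not (a ∈ᵇ β)) →
  distinct (α ++ β) ≡ distinct α ∧ distinct β
distinct-++-disjoint []      β h = refl
distinct-++-disjoint (y ∷ α) β h = begin
    not (y ∈ᵇ (α ++ β)) ∧ distinct (α ++ β)
  ≡⟨ cong₂ (λ u w → not u ∧ w) (trans (∈-++ y α β) (cong ((y ∈ᵇ α) ∨_) y∉β))
                                (distinct-++-disjoint α β (Holds-tail y α h)) ⟩
    not ((y ∈ᵇ α) ∨ false) ∧ (distinct α ∧ distinct β)
  ≡⟨ cong (λ u → not u ∧ (distinct α ∧ distinct β)) (∨-identityʳ (y ∈ᵇ α)) ⟩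
    not (y ∈ᵇ α) ∧ (distinct α ∧ distinct β)
  ≡⟨ sym (∧-assoc (not (y ∈ᵇ α)) _ _) ⟩
    (not (y ∈ᵇ α) ∧ distinct α) ∧ distinct β ∎
  where
  open ≡-Reasoning
  y∉β : (y ∈ᵇ β) ≡ false
  y∉β = not-true (h y (∈-head y α))

leads231-intro : ∀ x α β a b → (a ∈ᵇ α) ≡ true → (x <ᵇ a) ≡ true →
  (b ∈ᵇ β) ≡ true → (b <ᵇ x) ≡ true → leads231 x (α ++ β) ≡ true
leads231-intro x (y ∷ α) β a b a∈α x<a b∈β b<x with a ≡ᵇ y in eq
... | true  = ∨-introˡ _ (∧-intro (subst (λ z → (x <ᵇ z) ≡ true) (≡ᵇ→≡ a y eq) x<a)
                                  (any-intro (α ++ β) b (∈-++ʳ b α β b∈β) b<x))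
  where
  any-intro : ∀ v y → (y ∈ᵇ v) ≡ true → (y <ᵇ x) ≡ true → any (_<ᵇ x) v ≡ true
  any-intro (z ∷ v) y m e with y ≡ᵇ z in eq′
  ... | true  = ∨-introˡ _ (subst (λ w → (w <ᵇ x) ≡ true) (≡ᵇ→≡ y z eq′) e)
  ... | false = ∨-introʳ _ (any-intro v y m e)
... | false = ∨-introʳ _ (leads231-intro x α β a b a∈α x<a b∈β b<x)

leads231-above : ∀ x β → Holds β (x <ᵇ_) → leads231 x β ≡ false
leads231-above x []      h = refl
leads231-above x (y ∷ β) h
  rewrite any-none (_<ᵇ x) β (λ z m → ≥→<ᵇ-false (<⇒≤ (<ᵇ→< x z (h z (∈-tail z y β m)))))
        | ∧-zeroʳ (x <ᵇ y) = leads231-above x β (Holds-tail y β h)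

leads231-++-above : ∀ x α β → Holds β (x <ᵇ_) → leads231 x (α ++ β) ≡ leads231 x α
leads231-++-above x []      β h = leads231-above x β h
leads231-++-above x (y ∷ α) β h =
  cong₂ (λ u w → ((x <ᵇ y) ∧ u) ∨ w) none-below-in-β (leads231-++-above x α β h)
  where
  none-below-in-β : any (_<ᵇ x) (α ++ β) ≡ any (_<ᵇ x) α
  none-below-in-β = begin
      any (_<ᵇ x) (α ++ β)
    ≡⟨ any-++ (_<ᵇ x) α β ⟩
      any (_<ᵇ x) α ∨ any (_<ᵇ x) β
    ≡⟨ cong (any (_<ᵇ x) α ∨_) (any-none (_<ᵇ x) β (λ z m → ≥→<ᵇ-false (<⇒≤ (<ᵇ→< x z (h z m))))) ⟩
      any (_<ᵇ x) α ∨ false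
    ≡⟨ ∨-identityʳ _ ⟩
      any (_<ᵇ x) α ∎
    where open ≡-Reasoning

leads231-below : ∀ x α → Holds α (_<ᵇ x) → leads231 x α ≡ false
leads231-below x []      h = refl
leads231-below x (y ∷ α) h rewrite ≥→<ᵇ-false {x} {y} (<⇒≤ (<ᵇ→< y x (h y (∈-head y α)))) =
  leads231-below x α (Holds-tail y α h)

has231-++ : ∀ x α β → Holds α (_<ᵇ x) → Holds β (x <ᵇ_) →
  has231 (α ++ β) ≡ has231 α ∨ has231 β
has231-++ x []      β hα hβ = refl
has231-++ x (y ∷ α) β hα hβ
  rewrite leads231-++-above y α β (λ z m → <→<ᵇ (<-trans (<ᵇ→< y x (hα y (∈-head y α))) (<ᵇ→< x z (hβ z m))))
        | has231-++ x α β (Holds-tail y α hα) hβ = sym (∨-assoc (leads231 y α) _ _)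

dropsAtMost-++ : ∀ B c α β → dropsAtMost B c (α ++ β) ≡ dropsAtMost B c α ∧ dropsAtMost B (c + length α) β
dropsAtMost-++ B c []      β = cong (λ z → true ∧ dropsAtMost B z β) (sym (+-identityʳ c))
dropsAtMost-++ B c (x ∷ α) β rewrite dropsAtMost-++ B (suc c) α β | +-suc c (length α) =
  sym (∧-assoc ((c ∸ x) ≤ᵇ B) _ _)

-- Descents across a split α < x < β: the head x descends into a nonempty α,
-- and the step from α (or x) up to β is an ascent.

sgn : ℕ → ℕ
sgn zero    = 0
sgn (suc _) = 1

descentsFrom-above : ∀ x β → Holds β (x <ᵇ_) → descentsFrom x β ≡ descents β
descentsFrom-above x []      h = refl
descentsFrom-above x (y ∷ β) h rewrite ≥→<ᵇ-false {y} {x} (<⇒≤ (<ᵇ→< x y (h y (∈-head y β)))) = refl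

descentsFrom-++ : ∀ x y α β → Holds (y ∷ α) (_<ᵇ x) → Holds β (x <ᵇ_) →
  descentsFrom y (α ++ β) ≡ descentsFrom y α + descents β
descentsFrom-++ x y []      β hα hβ =
  descentsFrom-above y β (λ z m → <→<ᵇ (<-trans (<ᵇ→< y x (hα y (∈-head y []))) (<ᵇ→< x z (hβ z m))))
descentsFrom-++ x y (z ∷ α) β hα hβ rewrite descentsFrom-++ x z α β (Holds-tail y (z ∷ α) hα) hβ =
  sym (+-assoc ⟦ z <ᵇ y ⟧ _ _)

descents-split : ∀ x k α β → length α ≡ k → Holds α (_<ᵇ x) → Holds β (x <ᵇ_) →
  descentsFrom x (α ++ β) ≡ sgn k + descents α + descents β
descents-split x .0                []      β refl hα hβ = descentsFrom-above x β hβ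
descents-split x .(suc (length α)) (y ∷ α) β refl hα hβ rewrite hα y (∈-head y α) =
  cong suc (descentsFrom-++ x y α β hα hβ)

window-end : ∀ o k (α β : List ℕ) → length α ≡ k → o + suc (length (α ++ β)) ≡ suc (o + k) + length β
window-end o k α β lα = begin
    o + suc (length (α ++ β))   ≡⟨ cong (λ z → o + suc z) (length-++ α {β}) ⟩
    o + suc (length α + j)      ≡⟨ cong (λ z → o + suc (z + j)) lα ⟩
    o + suc (k + j)             ≡⟨ +-suc o (k + j) ⟩
    suc (o + (k + j))           ≡⟨ cong suc (sym (+-assoc o k j)) ⟩
    suc (o + k) + j ∎
  where
  open ≡-Reasoning
  j = length β

module _ (B o c : ℕ) (v : List ℕ) (adm : admissible B o c v ≡ true) where
  private
    rest₁ = ∧-elimʳ {distinct v} adm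
    rest₂ = ∧-elimʳ {inWindow o (o + length v) v} rest₁

  adm-distinct : distinct v ≡ true
  adm-distinct = ∧-elimˡ {distinct v} adm

  adm-window : Holds v (λ y → (o ≤ᵇ y) ∧ (y <ᵇ o + length v))
  adm-window = all→Holds v (∧-elimˡ {inWindow o (o + length v) v} rest₁)

  adm-231 : has231 v ≡ false
  adm-231 = not-true (∧-elimˡ {not (has231 v)} rest₂)

no-room : ∀ lo a v → distinct (a ∷ v) ≡ true →
  Holds (a ∷ v) (λ y → (lo ≤ᵇ y) ∧ (y <ᵇ lo + length v)) → ⊥
no-room lo a v d h = 1+n≰n (pigeonhole (length v) lo (a ∷ v) d h)

-- If some letter of α were above x = o + k, 231-avoidance would put all of β
-- above x too, leaving |β| + 1 letters for the |β| values above x; if then some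
-- letter of β were below x, the k + 1 letters below x would not fit either.
module FirstLetter (B o c k : ℕ) (α β : List ℕ) (lα : length α ≡ k)
                   (adm : admissible B o c (o + k ∷ α ++ β) ≡ true) where

  x = o + k
  j = length β

  x∉αβ : (x ∈ᵇ (α ++ β)) ≡ false
  x∉αβ = not-true (∧-elimˡ {not (x ∈ᵇ (α ++ β))} (adm-distinct B o c (x ∷ α ++ β) adm))

  parts = distinct-++ α β (∧-elimʳ {not (x ∈ᵇ (α ++ β))} (adm-distinct B o c (x ∷ α ++ β) adm))

  x∤231 : leads231 x (α ++ β) ≡ false
  x∤231 = ∨-false-elimˡ (adm-231 B o c (x ∷ α ++ β) adm)

  inRange : ∀ y → (y ∈ᵇ (α ++ β)) ≡ true → (o ≤ᵇ y) ≡ true × y < suc x + j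
  inRange y m = ∧-elimˡ {o ≤ᵇ y} r , subst (y <_) (window-end o k α β lα) (<ᵇ→< y _ (∧-elimʳ {o ≤ᵇ y} r))
    where r = adm-window B o c (x ∷ α ++ β) adm y (∈-tail y x (α ++ β) m)

  ≢x : ∀ y → (y ∈ᵇ (α ++ β)) ≡ true → y ≢ x
  ≢x y m = ∉⇒≢ x (α ++ β) y x∉αβ m

  below : Holds α (_<ᵇ x)
  below a a∈α with x <ᵇ a in x<a
  ... | true  = ⊥-elim (no-room (suc x) a β (∧-intro (not-false (proj₂ (proj₂ parts) a a∈α)) (proj₁ (proj₂ parts))) room)
    where
    β-above : ∀ b → (b ∈ᵇ β) ≡ true → x < b
    β-above b b∈β with b <ᵇ x in b<x
    ... | true  = ⊥-elim (true≢false (leads231-intro x α β a b a∈α x<a b∈β b<x) x∤231)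
    ... | false = ≤∧≢⇒< (<ᵇ-false→≥ b x b<x) (λ p → ≢x b (∈-++ʳ b α β b∈β) (sym p))
    room : Holds (a ∷ β) (λ y → (suc x ≤ᵇ y) ∧ (y <ᵇ suc x + j))
    room = Holds-∷ a β (∧-intro (≤→≤ᵇ (<ᵇ→< x a x<a)) (<→<ᵇ (proj₂ (inRange a (∈-++ˡ a α β a∈α)))))
             (λ b b∈β → ∧-intro (≤→≤ᵇ (β-above b b∈β)) (<→<ᵇ (proj₂ (inRange b (∈-++ʳ b α β b∈β)))))
  ... | false = <→<ᵇ (≤∧≢⇒< (<ᵇ-false→≥ x a x<a) (≢x a (∈-++ˡ a α β a∈α)))

  above : Holds β (x <ᵇ_)
  above b b∈β with b <ᵇ x in b<x
  ... | true  = ⊥-elim (no-room o b α (∧-intro (not-false b∉α) (proj₁ parts)) (subst (λ z → Holds (b ∷ α) (λ y → (o ≤ᵇ y) ∧ (y <ᵇ o + z))) (sym lα) room))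
    where
    b∉α : (b ∈ᵇ α) ≡ false
    b∉α with b ∈ᵇ α in eq
    ... | true  = ⊥-elim (true≢false b∈β (proj₂ (proj₂ parts) b eq))
    ... | false = refl
    room : Holds (b ∷ α) (λ y → (o ≤ᵇ y) ∧ (y <ᵇ o + k))
    room = Holds-∷ b α (∧-intro (proj₁ (inRange b (∈-++ʳ b α β b∈β))) b<x)
             (λ a a∈α → ∧-intro (proj₁ (inRange a (∈-++ˡ a α β a∈α))) (below a a∈α))
  ... | false = <→<ᵇ (≤∧≢⇒< (<ᵇ-false→≥ b x b<x) (λ p → ≢x b (∈-++ʳ b α β b∈β) (sym p)))

first-letter-splits : ∀ B o c k α β → length α ≡ k → admissible B o c (o + k ∷ α ++ β) ≡ true →
  Holds α (_<ᵇ (o + k)) × Holds β ((o + k) <ᵇ_)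
first-letter-splits B o c k α β lα adm = below , above
  where open FirstLetter B o c k α β lα adm

windows-split : ∀ B o c c′ k α β → length α ≡ k →
  admissible B o c α ≡ true → admissible B (suc (o + k)) c′ β ≡ true →
  Holds α (_<ᵇ (o + k)) × Holds β ((o + k) <ᵇ_)
windows-split B o c c′ k α β lα admα admβ = below , above
  where
  below : Holds α (_<ᵇ (o + k))
  below y m = subst (λ z → (y <ᵇ (o + z)) ≡ true) lα
                (∧-elimʳ {o ≤ᵇ y} (adm-window B o c α admα y m))
  above : Holds β ((o + k) <ᵇ_)
  above y m = <→<ᵇ (≤ᵇ→≤ (suc (o + k)) y (∧-elimˡ {suc (o + k) ≤ᵇ y} (adm-window B (suc (o + k)) c′ β admβ y m)))

regroup : ∀ d₁ d₂ w₁ w₂ n₁ n₂ h r₁ r₂ →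
  (d₁ ∧ d₂) ∧ ((w₁ ∧ w₂) ∧ ((n₁ ∧ n₂) ∧ (h ∧ (r₁ ∧ r₂)))) ≡
  (h ∧ (d₁ ∧ (w₁ ∧ (n₁ ∧ r₁)))) ∧ (d₂ ∧ (w₂ ∧ (n₂ ∧ r₂)))
regroup d₁ d₂ w₁ w₂ n₁ n₂ true r₁ r₂
  rewrite ∧-interchange n₁ n₂ r₁ r₂
        | ∧-interchange w₁ w₂ (n₁ ∧ r₁) (n₂ ∧ r₂)
        | ∧-interchange d₁ d₂ (w₁ ∧ (n₁ ∧ r₁)) (w₂ ∧ (n₂ ∧ r₂)) = refl
regroup d₁ d₂ w₁ w₂ n₁ n₂ false r₁ r₂
  rewrite ∧-zeroʳ (n₁ ∧ n₂) | ∧-zeroʳ (w₁ ∧ w₂) | ∧-zeroʳ (d₁ ∧ d₂) = refl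

admissible-factors : ∀ B o c k α β → length α ≡ k →
  Holds α (_<ᵇ (o + k)) → Holds β ((o + k) <ᵇ_) →
  admissible B o c (o + k ∷ α ++ β) ≡
  (((c ∸ (o + k)) ≤ᵇ B) ∧ admissible B o (suc c) α) ∧ admissible B (suc (o + k)) (suc c + k) β
admissible-factors B o c k α β lα below above = begin
    distinct W ∧ (inWindow o hi W ∧ (not (has231 W) ∧ dropsAtMost B c W))
  ≡⟨ cong₂ (λ u w → u ∧ (w ∧ (not (has231 W) ∧ dropsAtMost B c W))) distinct-W window-W ⟩
    (dα ∧ dβ) ∧ ((wα ∧ wβ) ∧ (not (has231 W) ∧ dropsAtMost B c W))
  ≡⟨ cong₂ (λ u w → (dα ∧ dβ) ∧ ((wα ∧ wβ) ∧ (u ∧ w))) avoid-W drops-W ⟩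
    (dα ∧ dβ) ∧ ((wα ∧ wβ) ∧ ((not (has231 α) ∧ not (has231 β)) ∧ (h ∧ (rα ∧ rβ))))
  ≡⟨ regroup dα dβ wα wβ (not (has231 α)) (not (has231 β)) h rα rβ ⟩
    (h ∧ admissible B o (suc c) α) ∧ admissible B (suc x) (suc c + k) β ∎
  where
  open ≡-Reasoning
  x = o + k
  j = length β
  W = x ∷ α ++ β
  hi = o + suc (length (α ++ β))
  h = (c ∸ x) ≤ᵇ B
  dα = distinct α
  dβ = distinct β
  wα = inWindow o (o + length α) α
  wβ = inWindow (suc x) (suc x + j) β
  rα = dropsAtMost B (suc c) α
  rβ = dropsAtMost B (suc c + k) β
  x≮x : (x <ᵇ x) ≡ false
  x≮x = ≥→<ᵇ-false {x} {x} ≤-refl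

  distinct-W : distinct W ≡ dα ∧ dβ
  distinct-W = cong₂ (λ u w → not u ∧ w) x∉αβ
    (distinct-++-disjoint α β (λ a m → not-false (∉-Holds β a above (≥→<ᵇ-false (<⇒≤ (<ᵇ→< a x (below a m)))))))
    where
    x∉αβ : x ∈ᵇ (α ++ β) ≡ false
    x∉αβ = trans (∈-++ x α β) (cong₂ _∨_ (∉-Holds α x below x≮x) (∉-Holds β x above x≮x))

  window-W : inWindow o hi W ≡ wα ∧ wβ
  window-W = cong₂ _∧_ x-inside
    (trans (all-++ _ α β) (cong₂ _∧_ (all-cong α α-inside) (all-cong β β-inside)))
    where
    x<hi : x < hi
    x<hi = subst (x <_) (sym (window-end o k α β lα)) (≤-trans (n<1+n x) (m≤m+n (suc x) j))
    x-inside : ((o ≤ᵇ x) ∧ (x <ᵇ hi)) ≡ true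
    x-inside = ∧-intro (≤→≤ᵇ (m≤m+n o k)) (<→<ᵇ x<hi)
    α-inside : ∀ y → (y ∈ᵇ α) ≡ true → ((o ≤ᵇ y) ∧ (y <ᵇ hi)) ≡ ((o ≤ᵇ y) ∧ (y <ᵇ o + length α))
    α-inside y m = cong ((o ≤ᵇ y) ∧_) (trans (<→<ᵇ (<-trans y<x x<hi)) (sym (trans (cong (λ z → y <ᵇ o + z) lα) (below y m))))
      where y<x = <ᵇ→< y x (below y m)
    β-inside : ∀ y → (y ∈ᵇ β) ≡ true → ((o ≤ᵇ y) ∧ (y <ᵇ hi)) ≡ ((suc x ≤ᵇ y) ∧ (y <ᵇ suc x + j))
    β-inside y m = cong₂ _∧_ (trans (≤→≤ᵇ (≤-trans (m≤m+n o k) (<⇒≤ x<y))) (sym (≤→≤ᵇ x<y)))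
                             (cong (y <ᵇ_) (window-end o k α β lα))
      where x<y = <ᵇ→< x y (above y m)

  avoid-W : not (has231 W) ≡ not (has231 α) ∧ not (has231 β)
  avoid-W = trans (cong not (cong₂ _∨_ x-leads-none (has231-++ x α β below above)))
                  (not-∨ (has231 α) (has231 β))
    where
    x-leads-none : leads231 x (α ++ β) ≡ false
    x-leads-none = trans (leads231-++-above x α β above) (leads231-below x α below)

  drops-W : dropsAtMost B c W ≡ h ∧ (rα ∧ rβ)
  drops-W = cong (h ∧_) (trans (dropsAtMost-++ B (suc c) α β)
                               (cong (λ z → rα ∧ dropsAtMost B (suc c + z) β) lα))

-- Decomposition: by the first-letter split, the factorization holds unconditionally.
admissible-decomposes : ∀ B o c k α β → length α ≡ k →
  admissible B o c (o + k ∷ α ++ β) ≡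
  (((c ∸ (o + k)) ≤ᵇ B) ∧ admissible B o (suc c) α) ∧ admissible B (suc (o + k)) (suc c + k) β
admissible-decomposes B o c k α β lα = bool-ext
  (λ adm → let (below , above) = first-letter-splits B o c k α β lα adm
           in trans (sym (admissible-factors B o c k α β lα below above)) adm)
  (λ e → let admα = ∧-elimʳ {(c ∸ (o + k)) ≤ᵇ B} (∧-elimˡ {((c ∸ (o + k)) ≤ᵇ B) ∧ admissible B o (suc c) α} e)
             admβ = ∧-elimʳ {((c ∸ (o + k)) ≤ᵇ B) ∧ admissible B o (suc c) α} e
             (below , above) = windows-split B o (suc c) (suc c + k) k α β lα admα admβ
         in trans (admissible-factors B o c k α β lα below above) e)

⟦∧⟧ : ∀ a b → ⟦ a ∧ b ⟧ ≡ ⟦ a ⟧ * ⟦ b ⟧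
⟦∧⟧ true  b = sym (+-identityʳ ⟦ b ⟧)
⟦∧⟧ false b = refl

tally : {A : Set} → (A → Bool) → List A → ℕ
tally p []       = 0
tally p (x ∷ xs) = ⟦ p x ⟧ + tally p xs

sumOver : {A : Set} → (A → ℕ) → List A → ℕ
sumOver f []       = 0
sumOver f (x ∷ xs) = f x + sumOver f xs

length-filter : {A : Set} (p : A → Bool) (xs : List A) → length (filterᵇ p xs) ≡ tally p xs
length-filter p [] = refl
length-filter p (x ∷ xs) with p x
... | true  = cong suc (length-filter p xs)
... | false = length-filter p xs

tally-filter : {A : Set} (p q : A → Bool) (xs : List A) →
  tally p (filterᵇ q xs) ≡ tally (λ x → q x ∧ p x) xs
tally-filter p q [] = refl
tally-filter p q (x ∷ xs) with q x
... | true  = cong (⟦ p x ⟧ +_) (tally-filter p q xs)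
... | false = tally-filter p q xs

tally-map : {A B : Set} (p : B → Bool) (f : A → B) (xs : List A) → tally p (map f xs) ≡ tally (p ∘ f) xs
tally-map p f []       = refl
tally-map p f (x ∷ xs) = cong (⟦ p (f x) ⟧ +_) (tally-map p f xs)

tally-cong : {A : Set} {p q : A → Bool} (xs : List A) → All (λ x → p x ≡ q x) xs → tally p xs ≡ tally q xs
tally-cong []       []       = refl
tally-cong (x ∷ xs) (e ∷ es) = cong₂ _+_ (cong ⟦_⟧ e) (tally-cong xs es)

tally-none : {A : Set} {p : A → Bool} (xs : List A) → All (λ x → p x ≡ false) xs → tally p xs ≡ 0
tally-none []       []       = refl
tally-none (x ∷ xs) (e ∷ es) rewrite e = tally-none xs es

tally-guard : {A : Set} (c : Bool) (q : A → Bool) (xs : List A) → tally (λ x → c ∧ q x) xs ≡ ⟦ c ⟧ * tally q xs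
tally-guard true  q xs = sym (+-identityʳ _)
tally-guard false q []       = refl
tally-guard false q (x ∷ xs) = tally-guard false q xs

tally-+ : {A : Set} (p q r : A → Bool) (xs : List A) → All (λ x → ⟦ p x ⟧ + ⟦ q x ⟧ ≡ ⟦ r x ⟧) xs →
  tally p xs + tally q xs ≡ tally r xs
tally-+ p q r []       []       = refl
tally-+ p q r (x ∷ xs) (e ∷ es) =
  trans (+-interchange ⟦ p x ⟧ (tally p xs) ⟦ q x ⟧ (tally q xs)) (cong₂ _+_ e (tally-+ p q r xs es))

sumOver-cong : {A : Set} {f g : A → ℕ} (xs : List A) → All (λ x → f x ≡ g x) xs → sumOver f xs ≡ sumOver g xs
sumOver-cong []       []       = refl
sumOver-cong (x ∷ xs) (e ∷ es) = cong₂ _+_ e (sumOver-cong xs es)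

sumOver-++ : {A : Set} (f : A → ℕ) (xs ys : List A) → sumOver f (xs ++ ys) ≡ sumOver f xs + sumOver f ys
sumOver-++ f []       ys = refl
sumOver-++ f (x ∷ xs) ys = trans (cong (f x +_) (sumOver-++ f xs ys)) (sym (+-assoc (f x) _ _))

sumOver-map : {A B : Set} (f : B → ℕ) (g : A → B) (xs : List A) → sumOver f (map g xs) ≡ sumOver (f ∘ g) xs
sumOver-map f g []       = refl
sumOver-map f g (x ∷ xs) = cong (f (g x) +_) (sumOver-map f g xs)

sumOver-concatMap : {A B : Set} (h : B → ℕ) (f : A → List B) (xs : List A) →
  sumOver h (concatMap f xs) ≡ sumOver (λ x → sumOver h (f x)) xs
sumOver-concatMap h f []       = refl
sumOver-concatMap h f (x ∷ xs) =
  trans (sumOver-++ h (f x) (concatMap f xs)) (cong (sumOver h (f x) +_) (sumOver-concatMap h f xs))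

sumOver-scale : {A : Set} (c : ℕ) (f : A → ℕ) (xs : List A) → sumOver (λ x → c * f x) xs ≡ c * sumOver f xs
sumOver-scale c f []       = sym (*-zeroʳ c)
sumOver-scale c f (x ∷ xs) = trans (cong (c * f x +_) (sumOver-scale c f xs)) (sym (*-distribˡ-+ c (f x) _))

words : List ℕ → ℕ → List (List ℕ)
words U zero    = [] ∷ []
words U (suc m) = concatMap (λ x → map (x ∷_) (words U m)) U

words-length : ∀ U m → All (λ v → length v ≡ m) (words U m)
words-length U zero    = refl ∷ []
words-length U (suc m) = concat⁺ (map⁺ (All.universal prefixed U))
  where
  prefixed : ∀ x → All (λ v → length v ≡ suc m) (map (x ∷_) (words U m))
  prefixed x = map⁺ (All.map (cong suc) (words-length U m))

tally-concatMap : {A B : Set} (p : B → Bool) (f : A → List B) (xs : List A) →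
  tally p (concatMap f xs) ≡ sumOver (λ x → tally p (f x)) xs
tally-concatMap p f []       = refl
tally-concatMap p f (x ∷ xs) = trans (tally-++ (f x) (concatMap f xs)) (cong (tally p (f x) +_) (tally-concatMap p f xs))
  where
  tally-++ : ∀ ys zs → tally p (ys ++ zs) ≡ tally p ys + tally p zs
  tally-++ []       zs = refl
  tally-++ (y ∷ ys) zs = trans (cong (⟦ p y ⟧ +_) (tally-++ ys zs)) (sym (+-assoc ⟦ p y ⟧ _ _))

tally-words-suc : ∀ U (p : List ℕ → Bool) m →
  tally p (words U (suc m)) ≡ sumOver (λ x → tally (λ v → p (x ∷ v)) (words U m)) U
tally-words-suc U p m = trans (tally-concatMap p (λ x → map (x ∷_) (words U m)) U)
  (sumOver-cong U (All.universal (λ x → tally-map p (x ∷_) (words U m)) U))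

tally-words-++ : ∀ U (p : List ℕ → Bool) k j →
  tally p (words U (k + j)) ≡ sumOver (λ α → tally (λ β → p (α ++ β)) (words U j)) (words U k)
tally-words-++ U p zero    j = sym (+-identityʳ _)
tally-words-++ U p (suc k) j = begin
    tally p (words U (suc (k + j)))
  ≡⟨ tally-words-suc U p (k + j) ⟩
    sumOver (λ x → tally (λ v → p (x ∷ v)) (words U (k + j))) U
  ≡⟨ sumOver-cong U (All.universal (λ x → tally-words-++ U (λ v → p (x ∷ v)) k j) U) ⟩
    sumOver (λ x → sumOver (λ α → F (x ∷ α)) (words U k)) U
  ≡⟨ sumOver-cong U (All.universal (λ x → sym (sumOver-map F (x ∷_) (words U k))) U) ⟩
    sumOver (λ x → sumOver F (map (x ∷_) (words U k))) U
  ≡⟨ sym (sumOver-concatMap F (λ x → map (x ∷_) (words U k)) U) ⟩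
    sumOver F (words U (suc k)) ∎
  where
  open ≡-Reasoning
  F : List ℕ → ℕ
  F α = tally (λ β → p (α ++ β)) (words U j)

sumBelow : ℕ → (ℕ → ℕ) → ℕ
sumBelow zero    h = 0
sumBelow (suc n) h = h 0 + sumBelow n (h ∘ suc)

sumBelow-cong : ∀ n {f g : ℕ → ℕ} → (∀ k → k < n → f k ≡ g k) → sumBelow n f ≡ sumBelow n g
sumBelow-cong zero    e = refl
sumBelow-cong (suc n) e = cong₂ _+_ (e 0 (s≤s z≤n)) (sumBelow-cong n (λ k p → e (suc k) (s≤s p)))

sumBelow-zero : ∀ n {f : ℕ → ℕ} → (∀ k → f k ≡ 0) → sumBelow n f ≡ 0
sumBelow-zero zero    e = refl
sumBelow-zero (suc n) e rewrite e 0 = sumBelow-zero n (e ∘ suc)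

sumBelow-+ : ∀ n (f g : ℕ → ℕ) → sumBelow n (λ k → f k + g k) ≡ sumBelow n f + sumBelow n g
sumBelow-+ zero    f g = refl
sumBelow-+ (suc n) f g = trans (cong (f 0 + g 0 +_) (sumBelow-+ n (f ∘ suc) (g ∘ suc)))
                               (+-interchange (f 0) (g 0) _ _)

sumBelow-last : ∀ n (h : ℕ → ℕ) → sumBelow (suc n) h ≡ sumBelow n h + h n
sumBelow-last zero    h = +-comm (h 0) 0
sumBelow-last (suc n) h = trans (cong (h 0 +_) (sumBelow-last n (h ∘ suc))) (sym (+-assoc (h 0) _ _))

sumOver-upTo : ∀ (h : ℕ → ℕ) n → sumOver h (upTo n) ≡ sumBelow n h
sumOver-upTo h n = go id n
  where
  go : ∀ f n → sumOver h (applyUpTo f n) ≡ sumBelow n (h ∘ f)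
  go f zero    = refl
  go f (suc n) = cong (h (f 0) +_) (go (f ∘ suc) n)

sumBelow-window : ∀ o r n (h : ℕ → ℕ) → o + r ≤ n →
  (∀ x → x < o → h x ≡ 0) → (∀ x → o + r ≤ x → h x ≡ 0) →
  sumBelow n h ≡ sumBelow r (λ k → h (o + k))
sumBelow-window (suc o) r (suc n) h le low high rewrite low 0 (s≤s z≤n) =
  sumBelow-window o r n (h ∘ suc) (s≤s⁻¹ le) (λ x p → low (suc x) (s≤s p)) (λ x p → high (suc x) (s≤s p))
sumBelow-window zero zero    n       h le low high = sumBelow-zero n (λ k → high k z≤n)
sumBelow-window zero (suc r) (suc n) h le low high =
  cong (h 0 +_) (sumBelow-window zero r n (h ∘ suc) (s≤s⁻¹ le) (λ _ ()) (λ x p → high (suc x) (s≤s p)))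

sumBelow-delta : ∀ D y (H : ℕ → ℕ) → (∀ d → D < d → H d ≡ 0) →
  sumBelow (suc D) (λ d → ⟦ y ≡ᵇ d ⟧ * H d) ≡ H y
sumBelow-delta D       zero    H v = trans (cong₂ _+_ (+-identityʳ (H 0)) (sumBelow-zero D (λ k → refl))) (+-identityʳ (H 0))
sumBelow-delta zero    (suc y) H v = sym (v (suc y) (s≤s z≤n))
sumBelow-delta (suc D) (suc y) H v = sumBelow-delta D y (H ∘ suc) (λ d p → v (suc d) (s≤s p))

group-by : ∀ {A : Set} D (g : A → Bool) (st : A → ℕ) (H : ℕ → ℕ) → (∀ d → D < d → H d ≡ 0) →
  (xs : List A) →
  sumOver (λ a → ⟦ g a ⟧ * H (st a)) xs ≡ sumBelow (suc D) (λ d → tally (λ a → g a ∧ (st a ≡ᵇ d)) xs * H d)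
group-by D g st H v []       = sym (sumBelow-zero D (λ k → refl))
group-by D g st H v (x ∷ xs) = begin
    ⟦ g x ⟧ * H (st x) + sumOver (λ a → ⟦ g a ⟧ * H (st a)) xs
  ≡⟨ cong₂ _+_ head-term (group-by D g st H v xs) ⟩
    sumBelow (suc D) (λ d → ⟦ g x ∧ (st x ≡ᵇ d) ⟧ * H d) + sumBelow (suc D) (λ d → #xs d * H d)
  ≡⟨ sym (sumBelow-+ (suc D) (λ d → ⟦ g x ∧ (st x ≡ᵇ d) ⟧ * H d) (λ d → #xs d * H d)) ⟩
    sumBelow (suc D) (λ d → ⟦ g x ∧ (st x ≡ᵇ d) ⟧ * H d + #xs d * H d)
  ≡⟨ sumBelow-cong (suc D) (λ d _ → sym (*-distribʳ-+ (H d) ⟦ g x ∧ (st x ≡ᵇ d) ⟧ (#xs d))) ⟩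
    sumBelow (suc D) (λ d → tally (λ a → g a ∧ (st a ≡ᵇ d)) (x ∷ xs) * H d) ∎
  where
  open ≡-Reasoning
  #xs : ℕ → ℕ
  #xs d = tally (λ a → g a ∧ (st a ≡ᵇ d)) xs
  head-term : ⟦ g x ⟧ * H (st x) ≡ sumBelow (suc D) (λ d → ⟦ g x ∧ (st x ≡ᵇ d) ⟧ * H d)
  head-term with g x
  ... | true  = trans (+-identityʳ (H (st x))) (sym (sumBelow-delta D (st x) H v))
  ... | false = sym (sumBelow-zero (suc D) (λ k → refl))

-- Convolution sums: Σ_{k + j = m, k ≥ 1} F k j and Σ_{k + j = m} F k j.

convolution⁺ : ℕ → (ℕ → ℕ → ℕ) → ℕ
convolution⁺ zero    F = 0
convolution⁺ (suc m) F = F 1 m + convolution⁺ m (λ k j → F (suc k) j)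

convolution : ℕ → (ℕ → ℕ → ℕ) → ℕ
convolution m F = F 0 m + convolution⁺ m F

sumBelow-convolution : ∀ m (F : ℕ → ℕ → ℕ) → sumBelow (suc m) (λ k → F k (m ∸ k)) ≡ convolution m F
sumBelow-convolution m F = cong (F 0 m +_) (go m F)
  where
  go : ∀ m (F : ℕ → ℕ → ℕ) → sumBelow m (λ k → F (suc k) (m ∸ suc k)) ≡ convolution⁺ m F
  go zero    F = refl
  go (suc m) F = cong (F 1 m +_) (go m (λ k j → F (suc k) j))

convolution⁺-cong : ∀ m {F G : ℕ → ℕ → ℕ} → (∀ k j → suc k + j ≡ m → F (suc k) j ≡ G (suc k) j) →
  convolution⁺ m F ≡ convolution⁺ m G
convolution⁺-cong zero    e = refl
convolution⁺-cong (suc m) e = cong₂ _+_ (e 0 m refl) (convolution⁺-cong m (λ k j p → e (suc k) j (cong suc p)))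

convolution⁺-zero : ∀ m {F : ℕ → ℕ → ℕ} → (∀ k j → suc k + j ≡ m → F (suc k) j ≡ 0) → convolution⁺ m F ≡ 0
convolution⁺-zero zero    e = refl
convolution⁺-zero (suc m) e = cong₂ _+_ (e 0 m refl) (convolution⁺-zero m (λ k j p → e (suc k) j (cong suc p)))

convolution⁺-+ : ∀ m (F G : ℕ → ℕ → ℕ) →
  convolution⁺ m (λ k j → F k j + G k j) ≡ convolution⁺ m F + convolution⁺ m G
convolution⁺-+ zero    F G = refl
convolution⁺-+ (suc m) F G =
  trans (cong (F 1 m + G 1 m +_) (convolution⁺-+ m (λ k j → F (suc k) j) (λ k j → G (suc k) j)))
        (+-interchange (F 1 m) (G 1 m) _ _)

convolution⁺-const : ∀ m c → convolution⁺ m (λ _ _ → c) ≡ m * c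
convolution⁺-const zero    c = refl
convolution⁺-const (suc m) c = cong (c +_) (convolution⁺-const m c)

convolution⁺-right : ∀ m (g : ℕ → ℕ) → convolution⁺ m (λ _ j → g j) ≡ sumBelow m g
convolution⁺-right zero    g = refl
convolution⁺-right (suc m) g =
  trans (cong (g m +_) (convolution⁺-right m g)) (trans (+-comm (g m) _) (sym (sumBelow-last m g)))

convolution⁺-left : ∀ m (g : ℕ → ℕ) → convolution⁺ m (λ k _ → g k) ≡ sumBelow m (g ∘ suc)
convolution⁺-left zero    g = refl
convolution⁺-left (suc m) g = cong (g 1 +_) (convolution⁺-left m (g ∘ suc))

hockey-stick : ∀ m r → sumBelow m (λ j → j C r) ≡ m C suc r
hockey-stick zero    r = refl
hockey-stick (suc m) r = begin
    sumBelow (suc m) (λ j → j C r)   ≡⟨ sumBelow-last m (λ j → j C r) ⟩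
    sumBelow m (λ j → j C r) + m C r ≡⟨ cong (_+ m C r) (hockey-stick m r) ⟩
    m C suc r + m C r                ≡⟨ +-comm (m C suc r) (m C r) ⟩
    m C r + m C suc r                ≡⟨ nCk+nC[k+1]≡[n+1]C[k+1] m r ⟩
    suc m C suc r ∎
  where open ≡-Reasoning

counted : ℕ → ℕ → ℕ → ℕ → ℕ → List ℕ → Bool
counted B o c a d v = admissible B o c v ∧ ((a + descents v) ≡ᵇ d)

-- The decomposition in terms of the slack s = c − o: the head has drop s − k,
-- α keeps the window start o with slack s + 1, β starts at o + k + 1 with slack s.
counted-decomposes : ∀ B o s a d k α β → length α ≡ k →
  counted B o (o + s) a d (o + k ∷ α ++ β) ≡
  (((s ∸ k) ≤ᵇ B) ∧ admissible B o (o + suc s) α) ∧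
  counted B (suc (o + k)) (suc (o + k) + s) ((a + sgn k) + descents α) d β
counted-decomposes B o s a d k α β lα = begin
    admissible B o (o + s) (o + k ∷ α ++ β) ∧ D
  ≡⟨ cong (_∧ D) (trans (admissible-decomposes B o (o + s) k α β lα)
                        (cong₂ (λ u w → u ∧ admissible B (suc (o + k)) w β) head-and-α slack-of-β)) ⟩
    (h ∧ admβ) ∧ D
  ≡⟨ ∧-congʳ-when (h ∧ admβ) descents-agree ⟩
    (h ∧ admβ) ∧ D′
  ≡⟨ ∧-assoc h admβ D′ ⟩
    h ∧ (admβ ∧ D′) ∎
  where
  open ≡-Reasoning
  D  = (a + descentsFrom (o + k) (α ++ β)) ≡ᵇ d
  D′ = (((a + sgn k) + descents α) + descents β) ≡ᵇ d
  h = ((s ∸ k) ≤ᵇ B) ∧ admissible B o (o + suc s) α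
  admβ = admissible B (suc (o + k)) (suc (o + k) + s) β
  head-and-α : (((o + s) ∸ (o + k)) ≤ᵇ B) ∧ admissible B o (suc (o + s)) α ≡ h
  head-and-α = cong₂ (λ u w → (u ≤ᵇ B) ∧ admissible B o w α) ([m+n]∸[m+o]≡n∸o o s k) (sym (+-suc o s))
  slack-of-β : suc (o + s) + k ≡ suc (o + k) + s
  slack-of-β = cong suc (trans (+-assoc o s k) (trans (cong (o +_) (+-comm s k)) (sym (+-assoc o k s))))
  descents-agree : h ∧ admβ ≡ true → D ≡ D′
  descents-agree e = cong (_≡ᵇ d) (begin
      a + descentsFrom (o + k) (α ++ β)
    ≡⟨ cong (a +_) (descents-split (o + k) k α β lα below above) ⟩
      a + (sgn k + descents α + descents β)
    ≡⟨ sym (+-assoc a _ _) ⟩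
      a + (sgn k + descents α) + descents β
    ≡⟨ cong (_+ descents β) (sym (+-assoc a (sgn k) _)) ⟩
      a + sgn k + descents α + descents β ∎)
    where
    open ≡-Reasoning
    admα = ∧-elimʳ {(s ∸ k) ≤ᵇ B} (∧-elimˡ {h} e)
    split = windows-split B o (o + suc s) (suc (o + k) + s) k α β lα admα (∧-elimʳ {h} e)
    below = proj₁ split
    above = proj₂ split

-- M N B o s m a d: the number of words of length m over [0, N) that are
-- admissible on the window [o, o + m) from position o + s (slack s) and have
-- exactly d − a descents.
M : ℕ → ℕ → ℕ → ℕ → ℕ → ℕ → ℕ → ℕ
M N B o s m a d = tally (counted B o (o + s) a d) (words (upTo N) m)

M-empty : ∀ N B o s a d → M N B o s 0 a d ≡ ⟦ a ≡ᵇ d ⟧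
M-empty N B o s a d rewrite +-identityʳ a = +-identityʳ _

M-excess : ∀ N B o s m a d → d < a → M N B o s m a d ≡ 0
M-excess N B o s m a d d<a = tally-none (words (upTo N) m) (All.universal too-many _)
  where
  too-many : ∀ v → counted B o (o + s) a d v ≡ false
  too-many v rewrite ≢→≡ᵇ-false {a + descents v} {d} (λ e → <⇒≢ (≤-trans d<a (m≤m+n a (descents v))) (sym e)) =
    ∧-zeroʳ _

-- The words with first letter o + k: α of length k (slack s + 1) followed by β of
-- length j on the window above o + k (slack s), grouped by the descents of α.
term : ℕ → ℕ → ℕ → ℕ → ℕ → ℕ → ℕ → ℕ → ℕ
term N B o s a d k j = ⟦ (s ∸ k) ≤ᵇ B ⟧ *
  sumBelow (suc d) (λ d₁ → M N B o (suc s) k 0 d₁ * M N B (suc (o + k)) s j ((a + sgn k) + d₁) d)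

first-letter-count : ∀ N B o s a d k j →
  tally (λ t → counted B o (o + s) a d (o + k ∷ t)) (words (upTo N) (k + j)) ≡ term N B o s a d k j
first-letter-count N B o s a d k j = begin
    tally (λ t → counted B o (o + s) a d (o + k ∷ t)) (words U (k + j))
  ≡⟨ tally-words-++ U (λ t → counted B o (o + s) a d (o + k ∷ t)) k j ⟩
    sumOver (λ α → tally (λ β → counted B o (o + s) a d (o + k ∷ α ++ β)) (words U j)) (words U k)
  ≡⟨ sumOver-cong (words U k) (All.map (λ {α} → fixed-prefix α) (words-length U k)) ⟩
    sumOver (λ α → ⟦ h ⟧ * (⟦ admα α ⟧ * H (descents α))) (words U k)
  ≡⟨ sumOver-scale ⟦ h ⟧ (λ α → ⟦ admα α ⟧ * H (descents α)) (words U k) ⟩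
    ⟦ h ⟧ * sumOver (λ α → ⟦ admα α ⟧ * H (descents α)) (words U k)
  ≡⟨ cong (⟦ h ⟧ *_) (group-by d admα descents H H-excess (words U k)) ⟩
    term N B o s a d k j ∎
  where
  open ≡-Reasoning
  U = upTo N
  h = (s ∸ k) ≤ᵇ B
  admα = admissible B o (o + suc s)
  H : ℕ → ℕ
  H d₁ = M N B (suc (o + k)) s j ((a + sgn k) + d₁) d
  H-excess : ∀ d₁ → d < d₁ → H d₁ ≡ 0
  H-excess d₁ p = M-excess N B (suc (o + k)) s j _ d (≤-trans p (m≤n+m d₁ (a + sgn k)))
  fixed-prefix : ∀ α → length α ≡ k →
    tally (λ β → counted B o (o + s) a d (o + k ∷ α ++ β)) (words U j) ≡ ⟦ h ⟧ * (⟦ admα α ⟧ * H (descents α))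
  fixed-prefix α lα = begin
      tally (λ β → counted B o (o + s) a d (o + k ∷ α ++ β)) (words U j)
    ≡⟨ tally-cong (words U j) (All.universal (λ β → counted-decomposes B o s a d k α β lα) _) ⟩
      tally (λ β → (h ∧ admα α) ∧ counted B (suc (o + k)) (suc (o + k) + s) ((a + sgn k) + descents α) d β) (words U j)
    ≡⟨ tally-guard (h ∧ admα α) _ (words U j) ⟩
      ⟦ h ∧ admα α ⟧ * H (descents α)
    ≡⟨ cong (_* H (descents α)) (⟦∧⟧ h (admα α)) ⟩
      ⟦ h ⟧ * ⟦ admα α ⟧ * H (descents α)
    ≡⟨ *-assoc ⟦ h ⟧ ⟦ admα α ⟧ _ ⟩
      ⟦ h ⟧ * (⟦ admα α ⟧ * H (descents α)) ∎

-- The recurrence: sum over the first letter o + k, k ≤ m (no other letter of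
-- [0, N) starts an admissible word on [o, o + m + 1)).
M-recurrence : ∀ N B o s m a d → o + suc m ≤ N → M N B o s (suc m) a d ≡ convolution m (term N B o s a d)
M-recurrence N B o s m a d le = begin
    M N B o s (suc m) a d
  ≡⟨ tally-words-suc U (counted B o (o + s) a d) m ⟩
    sumOver starting U
  ≡⟨ sumOver-upTo starting N ⟩
    sumBelow N starting
  ≡⟨ sumBelow-window o (suc m) N starting le below-window above-window ⟩
    sumBelow (suc m) (λ k → starting (o + k))
  ≡⟨ sumBelow-cong (suc m) (λ k k≤m → by-first-letter k (s≤s⁻¹ k≤m)) ⟩
    sumBelow (suc m) (λ k → term N B o s a d k (m ∸ k))
  ≡⟨ sumBelow-convolution m (term N B o s a d) ⟩
    convolution m (term N B o s a d) ∎
  where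
  open ≡-Reasoning
  U = upTo N
  starting : ℕ → ℕ
  starting x = tally (λ t → counted B o (o + s) a d (x ∷ t)) (words U m)
  outside : ∀ x → ((o ≤ᵇ x) ∧ (x <ᵇ o + suc m)) ≡ false → starting x ≡ 0
  outside x e = tally-none (words U m) (All.map (λ {t} lt → none t lt) (words-length U m))
    where
    none : ∀ t → length t ≡ m → counted B o (o + s) a d (x ∷ t) ≡ false
    none t refl rewrite e | ∧-zeroʳ (distinct (x ∷ t)) = refl
  below-window : ∀ x → x < o → starting x ≡ 0
  below-window x p = outside x (cong (_∧ (x <ᵇ o + suc m)) (>→≤ᵇ-false p))
  above-window : ∀ x → o + suc m ≤ x → starting x ≡ 0
  above-window x p = outside x (trans (cong ((o ≤ᵇ x) ∧_) (≥→<ᵇ-false p)) (∧-zeroʳ _))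
  by-first-letter : ∀ k → k ≤ m → starting (o + k) ≡ term N B o s a d k (m ∸ k)
  by-first-letter k k≤m =
    trans (cong (λ z → tally (λ t → counted B o (o + s) a d (o + k ∷ t)) (words U z)) (sym (m+[n∸m]≡n k≤m)))
          (first-letter-count N B o s a d k (m ∸ k))

module Evaluation (N B : ℕ) where

  split-bounds : ∀ o k j m → k + j ≡ m → o + suc m ≤ N → o + k ≤ N × suc (o + k) + j ≤ N
  split-bounds o k j m e le =
    ≤-trans (+-monoʳ-≤ o (≤-trans (m≤m+n k j) (≤-trans (≤-reflexive e) (n≤1+n m)))) le ,
    ≤-trans (≤-reflexive (trans (cong suc (trans (+-assoc o k j) (cong (o +_) e))) (sym (+-suc o m)))) le

  -- for s ≤ B the head drop s ∸ k never exceeds the bound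
  term-within : ∀ o s a d k j → s ≤ B → term N B o s a d k j ≡
    sumBelow (suc d) (λ d₁ → M N B o (suc s) k 0 d₁ * M N B (suc (o + k)) s j ((a + sgn k) + d₁) d)
  term-within o s a d k j s≤B rewrite ≤→≤ᵇ {s ∸ k} {B} (≤-trans (m∸n≤m s k) s≤B) = +-identityʳ _

  -- a word starting with its least letter o is that letter followed by an
  -- admissible word on [o + 1, …) with the same slack
  term-first : ∀ o s a d m → s ≤ B → term N B o s a d 0 m ≡ M N B (suc o) s m a d
  term-first o s a d m s≤B = begin
      term N B o s a d 0 m
    ≡⟨ term-within o s a d 0 m s≤B ⟩
      sumBelow (suc d) (λ d₁ → M N B o (suc s) 0 0 d₁ * H d₁)
    ≡⟨ sumBelow-cong (suc d) (λ d₁ _ → cong (_* H d₁) (M-empty N B o (suc s) 0 d₁)) ⟩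
      sumBelow (suc d) (λ d₁ → ⟦ 0 ≡ᵇ d₁ ⟧ * H d₁)
    ≡⟨ sumBelow-delta d 0 H (λ d₁ p → M-excess N B _ s m _ d (≤-trans p (m≤n+m d₁ (a + 0)))) ⟩
      H 0
    ≡⟨ cong₂ (λ u w → M N B (suc u) s m w d) (+-identityʳ o) (trans (+-identityʳ _) (+-identityʳ a)) ⟩
      M N B (suc o) s m a d ∎
    where
    open ≡-Reasoning
    H : ℕ → ℕ
    H d₁ = M N B (suc (o + 0)) s m ((a + 0) + d₁) d

  -- With slack beyond B no nonempty word is admissible: the first letter would
  -- have to exceed o, which leaves a shorter word on [o, …) with even larger slack.
  M-overfull : ∀ m s → B < s → ∀ o a d → o + suc m ≤ N → M N B o s (suc m) a d ≡ 0
  M-overfull = <-rec (λ m → ∀ s → B < s → ∀ o a d → o + suc m ≤ N → M N B o s (suc m) a d ≡ 0) step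
    where
    step : ∀ m → (∀ {k} → k < m → ∀ s → B < s → ∀ o a d → o + suc k ≤ N → M N B o s (suc k) a d ≡ 0) →
      ∀ s → B < s → ∀ o a d → o + suc m ≤ N → M N B o s (suc m) a d ≡ 0
    step m IH s B<s o a d le = trans (M-recurrence N B o s m a d le) (cong₂ _+_ head-too-low rest-empty)
      where
      head-too-low : term N B o s a d 0 m ≡ 0
      head-too-low rewrite >→≤ᵇ-false {s} {B} B<s = refl
      rest-empty : convolution⁺ m (term N B o s a d) ≡ 0
      rest-empty = convolution⁺-zero m α-empty
        where
        α-empty : ∀ k j → suc k + j ≡ m → term N B o s a d (suc k) j ≡ 0
        α-empty k j e = trans (cong (⟦ (s ∸ suc k) ≤ᵇ B ⟧ *_) (sumBelow-zero (suc d) no-α)) (*-zeroʳ ⟦ (s ∸ suc k) ≤ᵇ B ⟧)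
          where
          no-α : ∀ d₁ → M N B o (suc s) (suc k) 0 d₁ * M N B (suc (o + suc k)) s j ((a + 1) + d₁) d ≡ 0
          no-α d₁ = cong (_* M N B (suc (o + suc k)) s j ((a + 1) + d₁) d)
            (IH (≤-trans (s≤s (m≤m+n k j)) (≤-reflexive e)) (suc s) (m<n⇒m<1+n B<s) o 0 d₁
                (proj₁ (split-bounds o (suc k) j m e le)))

  M-step : ∀ o s m a d → s ≤ B → o + suc m ≤ N →
    M N B o s (suc m) a d ≡ M N B (suc o) s m a d + convolution⁺ m (term N B o s a d)
  M-step o s m a d s≤B le =
    trans (M-recurrence N B o s m a d le) (cong (_+ convolution⁺ m (term N B o s a d)) (term-first o s a d m s≤B))

  shift-bound : ∀ o m → o + suc m ≤ N → suc o + m ≤ N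
  shift-bound o m le = ≤-trans (≤-reflexive (sym (+-suc o m))) le

  -- With slack exactly B only the increasing word o, o + 1, … is admissible.
  M-full : ∀ m o a d → o + m ≤ N → M N B o B m a d ≡ ⟦ a ≡ᵇ d ⟧
  M-full zero    o a d le = M-empty N B o B a d
  M-full (suc m) o a d le = begin
      M N B o B (suc m) a d
    ≡⟨ M-step o B m a d ≤-refl le ⟩
      M N B (suc o) B m a d + convolution⁺ m (term N B o B a d)
    ≡⟨ cong₂ _+_ (M-full m (suc o) a d (shift-bound o m le)) (convolution⁺-zero m α-empty) ⟩
      ⟦ a ≡ᵇ d ⟧ + 0
    ≡⟨ +-identityʳ _ ⟩
      ⟦ a ≡ᵇ d ⟧ ∎
    where
    open ≡-Reasoning
    α-empty : ∀ k j → suc k + j ≡ m → term N B o B a d (suc k) j ≡ 0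
    α-empty k j e = trans (term-within o B a d (suc k) j ≤-refl)
      (sumBelow-zero (suc d) (λ d₁ → cong (_* M N B (suc (o + suc k)) B j ((a + 1) + d₁) d)
        (M-overfull k (suc B) ≤-refl o 0 d₁ (proj₁ (split-bounds o (suc k) j m e le)))))

-- Room one (slack s, bound s + 1): the part α before the first letter has slack
-- s + 1 and is therefore increasing, so a first letter o + k only contributes
-- the count for β, with one more descent when α is nonempty.
term-room-one : ∀ N s o a d k j m → k + j ≡ m → o + suc m ≤ N →
  term N (suc s) o s a d k j ≡ M N (suc s) (suc (o + k)) s j (a + sgn k) d
term-room-one N s o a d k j m e le = begin
    term N (suc s) o s a d k j
  ≡⟨ term-within o s a d k j (n≤1+n s) ⟩
    sumBelow (suc d) (λ d₁ → M N (suc s) o (suc s) k 0 d₁ * H d₁)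
  ≡⟨ sumBelow-cong (suc d) (λ d₁ _ → cong (_* H d₁) (M-full k o 0 d₁ (proj₁ (split-bounds o k j m e le)))) ⟩
    sumBelow (suc d) (λ d₁ → ⟦ 0 ≡ᵇ d₁ ⟧ * H d₁)
  ≡⟨ sumBelow-delta d 0 H (λ d₁ p → M-excess N (suc s) _ s j _ d (≤-trans p (m≤n+m d₁ (a + sgn k)))) ⟩
    H 0
  ≡⟨ cong (λ w → M N (suc s) (suc (o + k)) s j w d) (+-identityʳ (a + sgn k)) ⟩
    M N (suc s) (suc (o + k)) s j (a + sgn k) d ∎
  where
  open ≡-Reasoning
  open Evaluation N (suc s)
  H : ℕ → ℕ
  H d₁ = M N (suc s) (suc (o + k)) s j ((a + sgn k) + d₁) d

-- With room one, the admissible words of length m with d descents are counted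
-- by C(m, 2d): a descent-free word is the identity, and otherwise summing over
-- the first letter gives C(m, 2d + 2) + Σ_{j < m} C(j, 2d) = C(m + 1, 2d + 2).
M-room-one : ∀ N s d m o → o + m ≤ N → M N (suc s) o s m 0 d ≡ m C (2 * d)
M-room-one N s zero    zero    o le = refl
M-room-one N s (suc d) zero    o le = refl
M-room-one N s zero    (suc m) o le = begin
    M N (suc s) o s (suc m) 0 0
  ≡⟨ M-step o s m 0 0 (n≤1+n s) le ⟩
    M N (suc s) (suc o) s m 0 0 + convolution⁺ m (term N (suc s) o s 0 0)
  ≡⟨ cong₂ _+_ (M-room-one N s 0 m (suc o) (shift-bound o m le)) (convolution⁺-zero m no-descent) ⟩
    1 ∎
  where
  open ≡-Reasoning
  open Evaluation N (suc s)
  no-descent : ∀ k j → suc k + j ≡ m → term N (suc s) o s 0 0 (suc k) j ≡ 0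
  no-descent k j e = trans (term-room-one N s o 0 0 (suc k) j m e le) (M-excess N (suc s) _ s j 1 0 (s≤s z≤n))
M-room-one N s (suc d) (suc m) o le = begin
    M N (suc s) o s (suc m) 0 (suc d)
  ≡⟨ M-step o s m 0 (suc d) (n≤1+n s) le ⟩
    M N (suc s) (suc o) s m 0 (suc d) + convolution⁺ m (term N (suc s) o s 0 (suc d))
  ≡⟨ cong₂ _+_ (M-room-one N s (suc d) m (suc o) (shift-bound o m le))
               (convolution⁺-cong m {G = λ _ j → j C (2 * d)} one-descent-fewer) ⟩
    m C (2 * suc d) + convolution⁺ m (λ _ j → j C (2 * d))
  ≡⟨ cong (m C (2 * suc d) +_) (trans (convolution⁺-right m (λ j → j C (2 * d))) (hockey-stick m (2 * d))) ⟩
    m C (2 * suc d) + m C suc (2 * d)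
  ≡⟨ cong (λ z → m C z + m C suc (2 * d)) double-suc ⟩
    m C suc (suc (2 * d)) + m C suc (2 * d)
  ≡⟨ +-comm (m C suc (suc (2 * d))) _ ⟩
    m C suc (2 * d) + m C suc (suc (2 * d))
  ≡⟨ nCk+nC[k+1]≡[n+1]C[k+1] m (suc (2 * d)) ⟩
    suc m C suc (suc (2 * d))
  ≡⟨ cong (suc m C_) (sym double-suc) ⟩
    suc m C (2 * suc d) ∎
  where
  open ≡-Reasoning
  open Evaluation N (suc s)
  double-suc : 2 * suc d ≡ suc (suc (2 * d))
  double-suc = cong suc (+-suc d (d + 0))
  -- a nonempty α costs one descent, leaving d for β (1 + x = d + 1 ⟺ x = d)
  one-descent-fewer : ∀ k j → suc k + j ≡ m → term N (suc s) o s 0 (suc d) (suc k) j ≡ j C (2 * d)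
  one-descent-fewer k j e = trans (term-room-one N s o 0 (suc d) (suc k) j m e le)
    (M-room-one N s d j (suc (o + suc k)) (proj₂ (split-bounds o (suc k) j m e le)))

-- Room two (slack s, bound s + 2): α has room one, so by the previous count a
-- first letter o + k with d₁ descents in α contributes C(k, 2 d₁) times the count for β.
term-room-two : ∀ N s o a d k j m → k + j ≡ m → o + suc m ≤ N →
  term N (suc (suc s)) o s a d k j ≡
  sumBelow (suc d) (λ d₁ → (k C (2 * d₁)) * M N (suc (suc s)) (suc (o + k)) s j ((a + sgn k) + d₁) d)
term-room-two N s o a d k j m e le =
  trans (term-within o s a d k j (≤-trans (n≤1+n s) (n≤1+n (suc s))))
        (sumBelow-cong (suc d) (λ d₁ _ → cong (_* M N (suc (suc s)) (suc (o + k)) s j ((a + sgn k) + d₁) d)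
           (M-room-one N (suc s) d₁ k o (proj₁ (split-bounds o k j m e le)))))
  where open Evaluation N (suc (suc s))

module RoomTwo (N s : ℕ) where
  open Evaluation N (suc (suc s))

  private
    B = suc (suc s)
    s≤B : s ≤ B
    s≤B = ≤-trans (n≤1+n s) (n≤1+n (suc s))

  M-room-two-0 : ∀ m o → o + m ≤ N → M N B o s m 0 0 ≡ 1
  M-room-two-0 zero    o le = refl
  M-room-two-0 (suc m) o le =
    trans (M-step o s m 0 0 s≤B le) (cong₂ _+_ (M-room-two-0 m (suc o) (shift-bound o m le)) (convolution⁺-zero m no-descent))
    where
    no-descent : ∀ k j → suc k + j ≡ m → term N B o s 0 0 (suc k) j ≡ 0
    no-descent k j e = trans (term-room-two N s o 0 0 (suc k) j m e le)
      (cong (λ z → 1 * z + 0) (M-excess N B _ s j 1 0 (s≤s z≤n)))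

  M-room-two-1 : ∀ m o → o + m ≤ N → M N B o s m 0 1 ≡ m C 2
  M-room-two-1 zero    o le = refl
  M-room-two-1 (suc m) o le = begin
      M N B o s (suc m) 0 1
    ≡⟨ M-step o s m 0 1 s≤B le ⟩
      M N B (suc o) s m 0 1 + convolution⁺ m (term N B o s 0 1)
    ≡⟨ cong₂ _+_ (M-room-two-1 m (suc o) (shift-bound o m le)) (convolution⁺-cong m {G = λ _ _ → 1} one) ⟩
      m C 2 + convolution⁺ m (λ _ _ → 1)
    ≡⟨ cong (m C 2 +_) (trans (convolution⁺-const m 1) (trans (*-identityʳ m) (sym (nC1≡n m)))) ⟩
      m C 2 + m C 1
    ≡⟨ +-comm (m C 2) (m C 1) ⟩
      m C 1 + m C 2
    ≡⟨ nCk+nC[k+1]≡[n+1]C[k+1] m 1 ⟩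
      suc m C 2 ∎
    where
    open ≡-Reasoning
    -- the single descent is the one into a nonempty α
    one : ∀ k j → suc k + j ≡ m → term N B o s 0 1 (suc k) j ≡ 1
    one k j e = begin
        term N B o s 0 1 (suc k) j
      ≡⟨ term-room-two N s o 0 1 (suc k) j m e le ⟩
        1 * M N B o′ s j 1 1 + ((suc k C 2) * M N B o′ s j 2 1 + 0)
      ≡⟨ cong₂ (λ u w → 1 * u + ((suc k C 2) * w + 0))
               (M-room-two-0 j o′ (proj₂ (split-bounds o (suc k) j m e le))) (M-excess N B o′ s j 2 1 (s≤s (s≤s z≤n))) ⟩
        1 + ((suc k C 2) * 0 + 0)
      ≡⟨ cong (λ z → 1 + (z + 0)) (*-zeroʳ (suc k C 2)) ⟩
        1 ∎
      where o′ = suc (o + suc k)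

  M-room-two-2 : ∀ m o → o + m ≤ N → M N B o s m 0 2 ≡ suc m C 4 + m C 4
  M-room-two-2 zero    o le = refl
  M-room-two-2 (suc m) o le = begin
      M N B o s (suc m) 0 2
    ≡⟨ M-step o s m 0 2 s≤B le ⟩
      M N B (suc o) s m 0 2 + convolution⁺ m (term N B o s 0 2)
    ≡⟨ cong₂ _+_ (M-room-two-2 m (suc o) (shift-bound o m le))
                 (convolution⁺-cong m {G = λ k j → j C 2 + k C 2} two) ⟩
      (suc m C 4 + m C 4) + convolution⁺ m (λ k j → j C 2 + k C 2)
    ≡⟨ cong ((suc m C 4 + m C 4) +_) (trans (convolution⁺-+ m (λ _ j → j C 2) (λ k _ → k C 2))
          (cong₂ _+_ (trans (convolution⁺-right m (λ j → j C 2)) (hockey-stick m 2))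
                     (trans (convolution⁺-left m (λ k → k C 2)) (hockey-stick (suc m) 2)))) ⟩
      (suc m C 4 + m C 4) + (m C 3 + suc m C 3)
    ≡⟨ rearrange (suc m C 4) (m C 4) (m C 3) (suc m C 3) ⟩
      (suc m C 3 + suc m C 4) + (m C 3 + m C 4)
    ≡⟨ cong₂ _+_ (nCk+nC[k+1]≡[n+1]C[k+1] (suc m) 3) (nCk+nC[k+1]≡[n+1]C[k+1] m 3) ⟩
      suc (suc m) C 4 + suc m C 4 ∎
    where
    open ≡-Reasoning
    rearrange : ∀ a b c d → (a + b) + (c + d) ≡ (d + a) + (c + b)
    rearrange a b c d = solve 4 (λ a b c d → (a :+ b) :+ (c :+ d) := (d :+ a) :+ (c :+ b)) refl a b c d
      where open +-*-Solver
    -- either α is ascending and β has one descent, or α has two descents and β none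
    two : ∀ k j → suc k + j ≡ m → term N B o s 0 2 (suc k) j ≡ j C 2 + suc k C 2
    two k j e = begin
        term N B o s 0 2 (suc k) j
      ≡⟨ term-room-two N s o 0 2 (suc k) j m e le ⟩
        1 * M N B o′ s j 1 2 + ((suc k C 2) * M N B o′ s j 2 2 + ((suc k C 4) * M N B o′ s j 3 2 + 0))
      ≡⟨ cong₂ (λ u w → 1 * u + ((suc k C 2) * w + ((suc k C 4) * M N B o′ s j 3 2 + 0)))
               (M-room-two-1 j o′ β-bound) (M-room-two-0 j o′ β-bound) ⟩
        1 * (j C 2) + ((suc k C 2) * 1 + ((suc k C 4) * M N B o′ s j 3 2 + 0))
      ≡⟨ cong (λ z → 1 * (j C 2) + ((suc k C 2) * 1 + ((suc k C 4) * z + 0))) (M-excess N B o′ s j 3 2 ≤-refl) ⟩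
        1 * (j C 2) + ((suc k C 2) * 1 + ((suc k C 4) * 0 + 0))
      ≡⟨ cong₂ (λ u w → u + ((suc k C 2) * 1 + (w + 0))) (*-identityˡ (j C 2)) (*-zeroʳ (suc k C 4)) ⟩
        j C 2 + ((suc k C 2) * 1 + 0)
      ≡⟨ cong (j C 2 +_) (trans (+-identityʳ _) (*-identityʳ (suc k C 2))) ⟩
        j C 2 + suc k C 2 ∎
      where
      o′ = suc (o + suc k)
      β-bound = proj₂ (split-bounds o (suc k) j m e le)

-- The statistics of Defs, defined for square vectors, extended to any
-- w : Vec (Fin N) m (and, for maxdrop, to positions starting at c); on
-- w : Vec (Fin n) n with c = 0 they are the Defs notions by definition.
module _ {N m : ℕ} (w : Vec (Fin N) m) where
  value : Fin m → ℕ
  value i = toℕ (lookup w i)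

  isPermᵛ : Bool
  isPermᵛ = allF m λ i → allF m λ j → not (i <F j) ∨ not (value i ≡ᵇ value j)

  contains231ᵛ : Bool
  contains231ᵛ = anyF m λ a → anyF m λ b → anyF m λ c →
    (a <F b) ∧ (b <F c) ∧ (value c <ᵇ value a) ∧ (value a <ᵇ value b)

  desᵛ : ℕ
  desᵛ = countF m λ i → anyF m λ j → (toℕ j ≡ᵇ suc (toℕ i)) ∧ (value j <ᵇ value i)

  maxdropFrom : ℕ → ℕ
  maxdropFrom c = maxF m λ i → (c + toℕ i) ∸ value i

  leads231ᵛ : ℕ → Bool
  leads231ᵛ x = anyF m λ b → anyF m λ c → (b <F c) ∧ ((value c <ᵇ x) ∧ (x <ᵇ value b))

letters : ∀ {N m} → Vec (Fin N) m → List ℕ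
letters w = toList (Vec.map toℕ w)

allF-cong : ∀ m {p q : Fin m → Bool} → (∀ i → p i ≡ q i) → allF m p ≡ allF m q
allF-cong zero    e = refl
allF-cong (suc m) e = cong₂ _∧_ (e fzero) (allF-cong m (λ i → e (fsuc i)))

anyF-cong : ∀ m {p q : Fin m → Bool} → (∀ i → p i ≡ q i) → anyF m p ≡ anyF m q
anyF-cong m e = cong not (allF-cong m (λ i → cong not (e i)))

anyF-suc : ∀ m (p : Fin (suc m) → Bool) → anyF (suc m) p ≡ p fzero ∨ anyF m (λ i → p (fsuc i))
anyF-suc m p with p fzero
... | true  = refl
... | false = refl

anyF-false : ∀ m → anyF m (λ _ → false) ≡ false
anyF-false zero    = refl
anyF-false (suc m) = anyF-false m

anyF-∧ʳ : ∀ m (f : Fin m → Bool) t → anyF m (λ i → f i ∧ t) ≡ t ∧ anyF m f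
anyF-∧ʳ zero    f t = sym (∧-zeroʳ t)
anyF-∧ʳ (suc m) f t
  rewrite anyF-suc m (λ i → f i ∧ t) | anyF-suc m f | anyF-∧ʳ m (λ i → f (fsuc i)) t
  with f fzero | t
... | true  | true  = refl
... | true  | false = refl
... | false | true  = refl
... | false | false = refl

maxF-cong : ∀ m {f g : Fin m → ℕ} → (∀ i → f i ≡ g i) → maxF m f ≡ maxF m g
maxF-cong zero    e = refl
maxF-cong (suc m) e = cong₂ _⊔_ (e fzero) (maxF-cong m (λ i → e (fsuc i)))

anyF-value : ∀ {N m} (g : ℕ → Bool) (w : Vec (Fin N) m) → anyF m (λ c → g (value w c)) ≡ any g (letters w)
anyF-value g []      = refl
anyF-value g (x ∷ w) = trans (anyF-suc _ (λ c → g (value (x ∷ w) c))) (cong (g (toℕ x) ∨_) (anyF-value g w))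

∉-letters : ∀ {N m} y (w : Vec (Fin N) m) → allF m (λ j → not (y ≡ᵇ value w j)) ≡ not (y ∈ᵇ letters w)
∉-letters y []      = refl
∉-letters y (x ∷ w) = trans (cong (not (y ≡ᵇ toℕ x) ∧_) (∉-letters y w)) (sym (not-∨ (y ≡ᵇ toℕ x) (y ∈ᵇ letters w)))

isPerm-letters : ∀ {N m} (w : Vec (Fin N) m) → isPermᵛ w ≡ distinct (letters w)
isPerm-letters []      = refl
isPerm-letters (x ∷ w) = cong₂ _∧_ (∉-letters (toℕ x) w) (isPerm-letters w)

leads231-letters : ∀ {N m} y (w : Vec (Fin N) m) → leads231ᵛ w y ≡ leads231 y (letters w)
leads231-letters y [] = refl
leads231-letters {N} {suc m} y (z ∷ w) = begin
    leads231ᵛ (z ∷ w) y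
  ≡⟨ anyF-suc m (λ b → anyF (suc m) λ c → occurs b c) ⟩
    anyF m (λ c → (value w c <ᵇ y) ∧ (y <ᵇ toℕ z)) ∨ leads231ᵛ w y
  ≡⟨ cong (_∨ leads231ᵛ w y) (anyF-∧ʳ m (λ c → value w c <ᵇ y) (y <ᵇ toℕ z)) ⟩
    ((y <ᵇ toℕ z) ∧ anyF m (λ c → value w c <ᵇ y)) ∨ leads231ᵛ w y
  ≡⟨ cong₂ (λ u v → ((y <ᵇ toℕ z) ∧ u) ∨ v) (anyF-value (_<ᵇ y) w) (leads231-letters y w) ⟩
    leads231 y (letters (z ∷ w)) ∎
  where
  open ≡-Reasoning
  occurs : Fin (suc m) → Fin (suc m) → Bool
  occurs b c = (b <F c) ∧ ((value (z ∷ w) c <ᵇ y) ∧ (y <ᵇ value (z ∷ w) b))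

contains231-letters : ∀ {N m} (w : Vec (Fin N) m) → contains231ᵛ w ≡ has231 (letters w)
contains231-letters [] = refl
contains231-letters {N} {suc m} (x ∷ w) = begin
    contains231ᵛ (x ∷ w)
  ≡⟨ anyF-suc m (λ a → anyF (suc m) λ b → anyF (suc m) λ c → occurs a b c) ⟩
    anyF (suc m) (λ b → anyF (suc m) λ c → occurs fzero b c) ∨
    anyF m (λ a → anyF (suc m) λ b → anyF (suc m) λ c → occurs (fsuc a) b c)
  ≡⟨ cong₂ _∨_ led-by-x (anyF-cong m led-later) ⟩
    leads231ᵛ w (toℕ x) ∨ contains231ᵛ w
  ≡⟨ cong₂ _∨_ (leads231-letters (toℕ x) w) (contains231-letters w) ⟩
    has231 (letters (x ∷ w)) ∎
  where
  open ≡-Reasoning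
  occurs : Fin (suc m) → Fin (suc m) → Fin (suc m) → Bool
  occurs a b c = (a <F b) ∧ (b <F c) ∧ (value (x ∷ w) c <ᵇ value (x ∷ w) a) ∧ (value (x ∷ w) a <ᵇ value (x ∷ w) b)
  -- occurrences starting at the first position (b = 0 is impossible)
  led-by-x : anyF (suc m) (λ b → anyF (suc m) λ c → occurs fzero b c) ≡ leads231ᵛ w (toℕ x)
  led-by-x = trans (anyF-suc m (λ b → anyF (suc m) λ c → occurs fzero b c))
                   (cong (_∨ leads231ᵛ w (toℕ x)) (anyF-false (suc m)))
  -- occurrences starting later lie in the tail (b = 0 and c = 0 are impossible)
  led-later : ∀ a → anyF (suc m) (λ b → anyF (suc m) λ c → occurs (fsuc a) b c) ≡
    anyF m (λ b → anyF m λ c → (a <F b) ∧ (b <F c) ∧ (value w c <ᵇ value w a) ∧ (value w a <ᵇ value w b))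
  led-later a = trans (anyF-suc m (λ b → anyF (suc m) λ c → occurs (fsuc a) b c))
    (trans (cong (_∨ anyF m (λ b → anyF (suc m) λ c → occurs (fsuc a) (fsuc b) c)) (anyF-false (suc m)))
      (anyF-cong m (λ b → trans (anyF-suc m (λ c → occurs (fsuc a) (fsuc b) c))
         (cong (_∨ anyF m (λ c → occurs (fsuc a) (fsuc b) (fsuc c))) (∧-zeroʳ (a <F b))))))

descentsFrom-letters : ∀ {N m} (x : Fin N) (w : Vec (Fin N) m) → desᵛ (x ∷ w) ≡ descentsFrom (toℕ x) (letters w)
descentsFrom-letters x [] = refl
descentsFrom-letters {N} {suc m} x (z ∷ w) = cong₂ _+_ first-step (descentsFrom-letters z w)
  where
  first-step : ⟦ anyF (suc m) (λ j → (toℕ j ≡ᵇ 0) ∧ (value (z ∷ w) j <ᵇ toℕ x)) ⟧ ≡ ⟦ toℕ z <ᵇ toℕ x ⟧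
  first-step rewrite anyF-suc m (λ j → (toℕ j ≡ᵇ 0) ∧ (value (z ∷ w) j <ᵇ toℕ x)) | anyF-false m
                   | ∨-identityʳ (toℕ z <ᵇ toℕ x) = refl

des-letters : ∀ {N m} (w : Vec (Fin N) m) → desᵛ w ≡ descents (letters w)
des-letters []      = refl
des-letters (x ∷ w) = descentsFrom-letters x w

⊔-≤ᵇ : ∀ a b B → ((a ⊔ b) ≤ᵇ B) ≡ (a ≤ᵇ B) ∧ (b ≤ᵇ B)
⊔-≤ᵇ a b B = bool-ext
  (λ e → ∧-intro (≤→≤ᵇ (≤-trans (m≤m⊔n a b) (≤ᵇ→≤ (a ⊔ b) B e))) (≤→≤ᵇ (≤-trans (m≤n⊔m a b) (≤ᵇ→≤ (a ⊔ b) B e))))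
  (λ e → ≤→≤ᵇ (⊔-lub (≤ᵇ→≤ a B (∧-elimˡ {a ≤ᵇ B} e)) (≤ᵇ→≤ b B (∧-elimʳ {a ≤ᵇ B} e))))

maxdrop-letters : ∀ {N m} B c (w : Vec (Fin N) m) → (maxdropFrom w c ≤ᵇ B) ≡ dropsAtMost B c (letters w)
maxdrop-letters B c [] = refl
maxdrop-letters {N} {suc m} B c (x ∷ w) = begin
    (((c + 0) ∸ toℕ x) ⊔ maxF m (λ i → (c + suc (toℕ i)) ∸ value w i)) ≤ᵇ B
  ≡⟨ cong (_≤ᵇ B) (cong₂ _⊔_ (cong (_∸ toℕ x) (+-identityʳ c))
                             (maxF-cong m (λ i → cong (_∸ value w i) (+-suc c (toℕ i))))) ⟩
    ((c ∸ toℕ x) ⊔ maxdropFrom w (suc c)) ≤ᵇ B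
  ≡⟨ ⊔-≤ᵇ (c ∸ toℕ x) (maxdropFrom w (suc c)) B ⟩
    ((c ∸ toℕ x) ≤ᵇ B) ∧ (maxdropFrom w (suc c) ≤ᵇ B)
  ≡⟨ cong (((c ∸ toℕ x) ≤ᵇ B) ∧_) (maxdrop-letters B (suc c) w) ⟩
    dropsAtMost B c (letters (x ∷ w)) ∎
  where open ≡-Reasoning

toℕ-allFin : ∀ n → map toℕ (allFin n) ≡ upTo n
toℕ-allFin n = trans (map-tabulate id toℕ) (go n id)
  where
  go : ∀ n (f : ℕ → ℕ) → tabulate {n = n} (f ∘ toℕ) ≡ applyUpTo f n
  go zero    f = refl
  go (suc n) f = cong (f 0 ∷_) (go n (f ∘ suc))

letters-allVecs : ∀ n m → map letters (allVecs (allFin n) m) ≡ words (upTo n) m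
letters-allVecs n zero    = refl
letters-allVecs n (suc m) = begin
    map letters (concatMap (λ x → map (x ∷_) vecs) (allFin n))
  ≡⟨ map-concatMap letters (λ x → map (x ∷_) vecs) (allFin n) ⟩
    concatMap (λ x → map letters (map (x ∷_) vecs)) (allFin n)
  ≡⟨ concatMap-cong (λ x → trans (sym (map-∘ vecs)) (trans (map-∘ vecs) (cong (map (toℕ x ∷_)) (letters-allVecs n m)))) (allFin n) ⟩
    concatMap (λ x → map (toℕ x ∷_) (words (upTo n) m)) (allFin n)
  ≡⟨ sym (concatMap-map (λ y → map (y ∷_) (words (upTo n) m)) toℕ (allFin n)) ⟩
    concatMap (λ y → map (y ∷_) (words (upTo n) m)) (map toℕ (allFin n))
  ≡⟨ cong (concatMap (λ y → map (y ∷_) (words (upTo n) m))) (toℕ-allFin n) ⟩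
    words (upTo n) (suc m) ∎
  where
  open ≡-Reasoning
  vecs = allVecs (allFin n) m

maxdropTwoDesTwo : List ℕ → Bool
maxdropTwoDesTwo v =
  distinct v ∧ (not (has231 v) ∧ ((dropsAtMost 2 0 v ∧ not (dropsAtMost 1 0 v)) ∧ (descents v ≡ᵇ 2)))

exactly-two : ∀ x → (x ≡ᵇ 2) ≡ (x ≤ᵇ 2) ∧ not (x ≤ᵇ 1)
exactly-two zero                = refl
exactly-two (suc zero)          = refl
exactly-two (suc (suc zero))    = refl
exactly-two (suc (suc (suc x))) = refl

count-as-words : ∀ n → countMaxdropDes n 2 2 ≡ tally maxdropTwoDesTwo (words (upTo n) n)
count-as-words n = begin
    countMaxdropDes n 2 2
  ≡⟨ length-filter (λ w → (maxdrop w ≡ᵇ 2) ∧ (des w ≡ᵇ 2)) (S231 n) ⟩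
    tally (λ w → (maxdrop w ≡ᵇ 2) ∧ (des w ≡ᵇ 2)) (S231 n)
  ≡⟨ tally-filter (λ w → (maxdrop w ≡ᵇ 2) ∧ (des w ≡ᵇ 2)) (λ w → not (contains231 w)) (perms n) ⟩
    tally (λ w → not (contains231 w) ∧ ((maxdrop w ≡ᵇ 2) ∧ (des w ≡ᵇ 2))) (perms n)
  ≡⟨ tally-filter (λ w → not (contains231 w) ∧ ((maxdrop w ≡ᵇ 2) ∧ (des w ≡ᵇ 2))) isPerm vecs ⟩
    tally (λ w → isPerm w ∧ (not (contains231 w) ∧ ((maxdrop w ≡ᵇ 2) ∧ (des w ≡ᵇ 2)))) vecs
  ≡⟨ tally-cong vecs (All.universal same-condition vecs) ⟩
    tally (maxdropTwoDesTwo ∘ letters) vecs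
  ≡⟨ sym (tally-map maxdropTwoDesTwo letters vecs) ⟩
    tally maxdropTwoDesTwo (map letters vecs)
  ≡⟨ cong (tally maxdropTwoDesTwo) (letters-allVecs n n) ⟩
    tally maxdropTwoDesTwo (words (upTo n) n) ∎
  where
  open ≡-Reasoning
  vecs = allVecs (allFin n) n
  same-condition : ∀ (w : Vec (Fin n) n) →
    isPerm w ∧ (not (contains231 w) ∧ ((maxdrop w ≡ᵇ 2) ∧ (des w ≡ᵇ 2))) ≡ maxdropTwoDesTwo (letters w)
  same-condition w =
    cong₂ _∧_ (isPerm-letters w)
      (cong₂ (λ u v → not u ∧ v) (contains231-letters w)
        (cong₂ _∧_ (trans (exactly-two (maxdrop w))
                          (cong₂ (λ u v → u ∧ not v) (maxdrop-letters 2 0 w) (maxdrop-letters 1 0 w)))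
                   (cong (_≡ᵇ 2) (des-letters w))))

dropsAtMost-mono : ∀ {B B′} → B ≤ B′ → ∀ c v → dropsAtMost B c v ≡ true → dropsAtMost B′ c v ≡ true
dropsAtMost-mono B≤B′ c []      e = refl
dropsAtMost-mono {B} B≤B′ c (x ∷ v) e =
  ∧-intro (≤→≤ᵇ (≤-trans (≤ᵇ→≤ (c ∸ x) B (∧-elimˡ e)) B≤B′)) (dropsAtMost-mono B≤B′ (suc c) v (∧-elimʳ {(c ∸ x) ≤ᵇ B} e))

words-below : ∀ n m → All (λ v → all (_<ᵇ n) v ≡ true) (words (upTo n) m)
words-below n zero    = refl ∷ []
words-below n (suc m) = concat⁺ (map⁺ (All.map prefixed (applyUpTo⁺₁ id n <→<ᵇ)))
  where
  prefixed : ∀ {x} → (x <ᵇ n) ≡ true → All (λ v → all (_<ᵇ n) v ≡ true) (map (x ∷_) (words (upTo n) m))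
  prefixed x<n = map⁺ (All.map (∧-intro x<n) (words-below n m))

-- maxdrop = 2 means: all drops ≤ 2 but not all drops ≤ 1.  Hence the count of the
-- theorem is the difference of the counts for the bounds 2 and 1.
maxdrop-two-as-difference : ∀ n →
  tally maxdropTwoDesTwo (words (upTo n) n) + M n 1 0 0 n 0 2 ≡ M n 2 0 0 n 0 2
maxdrop-two-as-difference n =
  tally-+ _ _ _ (words (upTo n) n) (All.zipWith (λ {v} → per-word v) (words-length (upTo n) n , words-below n n))
  where
  split : ∀ d c b₁ b₂ e → (b₁ ≡ true → b₂ ≡ true) →
    ⟦ d ∧ (c ∧ ((b₂ ∧ not b₁) ∧ e)) ⟧ + ⟦ (d ∧ (true ∧ (c ∧ b₁))) ∧ e ⟧ ≡ ⟦ (d ∧ (true ∧ (c ∧ b₂))) ∧ e ⟧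
  split false c     b₁    b₂    e h = refl
  split true  false b₁    b₂    e h = refl
  split true  true  true  true  e h = refl
  split true  true  true  false e h with h refl
  ... | ()
  split true  true  false true  e h = +-comm ⟦ e ⟧ 0
  split true  true  false false e h = refl
  per-word : ∀ v → (length v ≡ n) × (all (_<ᵇ n) v ≡ true) →
    ⟦ maxdropTwoDesTwo v ⟧ + ⟦ counted 1 0 0 0 2 v ⟧ ≡ ⟦ counted 2 0 0 0 2 v ⟧
  per-word v (refl , in-window) rewrite in-window =
    split (distinct v) (not (has231 v)) (dropsAtMost 1 0 v) (dropsAtMost 2 0 v) (descents v ≡ᵇ 2)
          (dropsAtMost-mono (s≤s z≤n) 0 v)

-- The count with maxdrop exactly 2 is M₂ − M₁ = (C(n + 1, 4) + C(n, 4)) − C(n, 4).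
theorem5 : (n : ℕ) → 3 ≤ n → countMaxdropDes n 2 2 ≡ (n + 1) C 4
theorem5 n _ = +-cancelʳ-≡ (n C 4) _ _ (begin
    countMaxdropDes n 2 2 + n C 4
  ≡⟨ cong₂ _+_ (count-as-words n) (sym (M-room-one n 0 2 n 0 ≤-refl)) ⟩
    tally maxdropTwoDesTwo (words (upTo n) n) + M n 1 0 0 n 0 2
  ≡⟨ maxdrop-two-as-difference n ⟩
    M n 2 0 0 n 0 2
  ≡⟨ RoomTwo.M-room-two-2 n 0 n 0 ≤-refl ⟩
    suc n C 4 + n C 4
  ≡⟨ cong (λ m → m C 4 + n C 4) (+-comm 1 n) ⟩
    (n + 1) C 4 + n C 4 ∎)
  where open ≡-Reasoning
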